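{- Let $(E,\rho)$ be a polymatroid, fix $e\in E$ with $\rho(\{e\})>0$, and fix $e_1\in X_e$. Let $Y$ be a set consisting of exactly one element of $X_f$ for each $f\in E-e$ with $\rho(\{e,f\})=\rho(\{f\})$. Then the natural matroid $M_{\rho_{\downarrow e}}$ equals $M_\rho/e_1\setminus\bigl((X_e-e_1)\cup Y\bigr)$, where for each $f\in E-e$ the set corresponding to $f$ is $X_f-Y$. Likewise, if $\rho$ is a $k$-polymatroid, the $k$-natural matroid $M^k_{\rho_{\downarrow e}}$ equals $M^k_\rho/e_1\setminus(Y_e-e_1)$.
   Context: A (integer) polymatroid is $(E,\rho)$ with $E$ finite, $\rho:2^E\to\mathbb{Z}$ normalized, nondecreasing and submodular; a $k$-polymatroid has $\rho(\{e\})\le k$ for all $e$. Natural matroid $M_\rho$: pairwise disjoint sets $X_e$ with $|X_e|=\rho(\{e\})$, $X_A=\bigcup_{e\in A}X_e$, rank $r(X)=\min\{\rho(A)+|X-X_A|:A\subseteq E\}$ on $X_E$. The $k$-natural matroid $M^k_\rho$ is obtained from $M_\rho$ by, for each $e$, freely adding (iterated principal extension to $X_e$: each new element $u$ satisfies $r(Z\cup u)=r(Z)$ iff $X_e\subseteq\mathrm{cl}(Z)$) a set $U_e$ of $k-\rho(\{e\})$ new elements; $Y_e=X_e\cup U_e$. Compression: for $\rho(e)>0$, $\rho_{\downarrow e}$ is the polymatroid on $E-e$ with $\rho_{\downarrow e}(X)=\rho(X)-1$ if $\rho(X\cup e)=\rho(X)$ and $\rho_{\downarrow e}(X)=\rho(X)$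 otherwise. -}

module Defs where

open import Data.Nat using (ℕ; zero; suc; _+_; _∸_; _⊓_; _≤_)
open import Data.Nat.Properties using (_≟_)
open import Data.Bool using (Bool; true; false; if_then_else_; _∧_)
open import Data.Fin using (Fin; punchIn)
open import Data.Fin.Subset using (Subset; ⊥; ⁅_⁆; _∪_; _∩_; _─_; ∣_∣; _⊆_; _∈_; Empty; ⋃)
open import Data.List using (List; map; foldl)
open import Data.List using (foldr)
open import Data.Vec using (Vec; []; _∷_; lookup; insertAt; tabulate)
open import Data.Product using (_×_; ∃)
open import Relation.Nullary using (¬_; does)
open import Relation.Binary.PropositionalEquality using (_≡_; _≢_)
open import Data.List using (allFin)

-- Polymatroids on the ground set E = Fin n, subsets of E are `Subset n`.
-- Values are in ℕ (normalised + nondecreasing forces nonnegativity).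

record IsPolymatroid {n : ℕ} (ρ : Subset n → ℕ) : Set where
  field
    normalized  : ρ ⊥ ≡ 0
    monotone    : ∀ A B → A ⊆ B → ρ A ≤ ρ B
    submodular  : ∀ A B → ρ (A ∪ B) + ρ (A ∩ B) ≤ ρ A + ρ B

IsKPolymatroid : {n : ℕ} → ℕ → (Subset n → ℕ) → Set
IsKPolymatroid {n} k ρ = IsPolymatroid ρ × (∀ (e : Fin n) → ρ ⁅ e ⁆ ≤ k)

minSub : (n : ℕ) → (Subset n → ℕ) → ℕ
minSub zero    h = h []
minSub (suc n) h = minSub n (λ A → h (false ∷ A)) ⊓ minSub n (λ A → h (true ∷ A))

unionOver : {n m : ℕ} → (Fin n → Subset m) → Subset n → Subset m
unionOver {n} X A = ⋃ (map (λ f → if lookup A f then X f else ⊥) (allFin n))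

-- Natural matroid of ρ presented by the family (X_e) of subsets of a
-- universe Fin m: rank r(Z) = min { ρ(A) + |Z - X_A| : A ⊆ E }.

natRank : {n m : ℕ} → (Subset n → ℕ) → (Fin n → Subset m) → Subset m → ℕ
natRank {n} ρ X Z = minSub n (λ A → ρ A + ∣ Z ─ unionOver X A ∣)

-- Matroids given by rank functions r : Subset m → ℕ (meaningful on a
-- ground set inside Fin m).

inClosure : {m : ℕ} → (Subset m → ℕ) → Subset m → Fin m → Bool
inClosure r Z x = does (r (Z ∪ ⁅ x ⁆) ≟ r Z)

subsetClosure : {m : ℕ} → (Subset m → ℕ) → Subset m → Subset m → Bool
subsetClosure {m} r Z S =
  foldr (λ x b → (if lookup S x then inClosure r Z x else true) ∧ b) true (allFin m)

-- principal extension of r by the new element u, added freely to S: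
-- r'(Z ∪ u) = r(Z) iff S ⊆ cl(Z), otherwise r(Z) + 1.
principalExt : {m : ℕ} → (Subset m → ℕ) → Fin m → Subset m → Subset m → ℕ
principalExt r u S Z =
  if lookup Z u
  then r (Z ─ ⁅ u ⁆) + (if subsetClosure r (Z ─ ⁅ u ⁆) S then 0 else 1)
  else r Z

-- contraction of T: r_{M/T}(Z) = r(Z ∪ T) - r(T)   (deletion = restriction
-- of the domain, expressed by quantifying only over the remaining ground set)
contractRank : {m : ℕ} → (Subset m → ℕ) → Subset m → Subset m → ℕ
contractRank r T Z = r (Z ∪ T) ∸ r T

-- k-natural matroid: starting from M_ρ (presented by X), freely add,
-- for each f, the elements of U_f to X_f, one at a time by principal
-- extension (elements processed in increasing order of Fin m).

kNatRank : {n m : ℕ} → (Subset n → ℕ) → (Fin n → Subset m) → (Fin n → Subset m)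
         → Subset m → ℕ
kNatRank {n} {m} ρ X U =
  foldl (λ r u → foldl (λ r' f → if lookup (U f) u then principalExt r' u (X f) else r')
                       r (allFin n))
        (natRank ρ X) (allFin m)

-- Compression.  E = Fin (suc n), e : Fin (suc n); E - e is identified with
-- Fin n via punchIn e.

liftSub : {n : ℕ} → Fin (suc n) → Subset n → Subset (suc n)
liftSub e A = insertAt A e false

compress : {n : ℕ} → (Subset (suc n) → ℕ) → Fin (suc n) → Subset n → ℕ
compress ρ e A =
  if does (ρ (liftSub e A ∪ ⁅ e ⁆) ≟ ρ (liftSub e A))
  then ρ (liftSub e A) ∸ 1
  else ρ (liftSub e A)

PairwiseDisjoint : {n m : ℕ} → (Fin n → Subset m) → Set
PairwiseDisjoint X = ∀ f g → f ≢ g → Empty (X f ∩ X g)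

module Submission where

-- Write r(Z) = min_A ρ(A) + |Z − X_A| for the rank of the natural matroid. For Z avoiding X_e,
-- split the minimum defining r(Z ∪ e₁) according to whether e ∈ A: writing A for a subset of
-- E − e, the term at A + e is ρ(A + e) + |Z − X′_A| and the term at A is ρ(A) + 1 + |Z − X′_A|.
-- The compressed value ρ↓e(A) is exactly one less than min(ρ(A + e), ρ(A) + 1), so
-- r(Z ∪ e₁) = 1 + r↓e(Z), and r(e₁) = 1; this is the contraction formula.
--
-- Freely adding u to X_f agrees with the natural matroid of the family in which u has been put
-- into X_f: for Z ∋ u the principal extension has rank r(Z − u) if X_f ⊆ cl(Z − u) and
-- r(Z − u) + 1 otherwise, while the enlarged natural matroid has rank r(Z − u) exactly when some
-- minimiser for Z − u contains f, and these two conditions are equivalent. So the k-natural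
-- matroid is the natural matroid of the family X_f ∪ U_f. Deleting Y from the X_f and adding it
-- to the U_f leaves these unions unchanged, which reduces the k-natural statement to the first.

open import Defs
open import Data.Nat using (ℕ; zero; suc; _+_; _∸_; _⊓_; _≤_; _<_; s≤s; s≤s⁻¹; >-nonZero)
open import Data.Nat.Properties
  using (module ≤-Reasoning; ≤-refl; ≤-trans; ≤-antisym; ≤-reflexive; ≤∧≢⇒<; <-irrefl; n≤1+n; n<1+n;
         n≤0⇒n≡0; pred[n]≤n; suc-pred; +-suc; +-comm; +-assoc; +-identityʳ; +-monoˡ-≤; +-monoʳ-≤; +-mono-≤;
         m+n≤o⇒m≤o; m⊓n≤m; m⊓n≤n; ⊓-sel; _≟_)
import Data.Bool as Bool
open import Data.Bool using (Bool; true; false; _∨_; _∧_; not; if_then_else_)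
open import Data.Bool.Properties
  using (∨-zeroʳ; ∨-identityʳ; ∧-zeroʳ; ∧-identityʳ; ¬-not; not-involutive)
open import Data.Fin using (Fin; zero; suc; punchIn; punchOut)
import Data.Fin.Properties as Fin
open import Data.Fin.Subset using (Subset; ⊤; ⊥; ⁅_⁆; _∪_; _∩_; _─_; ∣_∣; _⊆_; _∈_; Empty; ⋃)
open import Data.Fin.Subset.Properties using (p⊆q⇒∣p∣≤∣q∣; ∣⊥∣≡0; ∣⁅x⁆∣≡1; ∪-identityˡ; ∪-comm; ∩-comm; p─⊥≡p)
open import Data.Vec using ([]; _∷_; lookup; insertAt; removeAt)
open import Data.Vec.Properties
  using (lookup-zipWith; lookup-replicate; []=⇒lookup; lookup⇒[]=; tabulate∘lookup; tabulate-cong;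
         insertAt-lookup; insertAt-punchIn; insertAt-removeAt)
open import Data.List as List using (List; []; _∷_; allFin)
open import Data.List.Relation.Unary.Any using (Any; here; there; satisfied)
open import Data.List.Relation.Unary.Any.Properties using (map⁺; map⁻)
open import Data.List.Relation.Unary.All as All using (All; []; _∷_)
open import Data.List.Relation.Unary.Unique.Propositional using (Unique; []; _∷_)
open import Data.List.Relation.Unary.Unique.Propositional.Properties using (allFin⁺)
open import Data.List.Membership.Propositional using (lose) renaming (_∈_ to _∈ₗ_)
open import Data.List.Membership.Propositional.Properties using (∈-allFin)
open import Data.Product using (_×_; ∃; _,_; proj₁; proj₂)
open import Data.Sum using (_⊎_; inj₁; inj₂)
open import Data.Empty using (⊥-elim) renaming (⊥ to ⊥₀)
open import Relation.Nullary using (¬_; Dec; does; yes; no)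
open import Relation.Nullary.Decidable using (dec-true; dec-false)
open import Relation.Binary.PropositionalEquality
  using (_≡_; _≢_; _≗_; refl; sym; trans; cong; cong₂; subst; module ≡-Reasoning)
open import Function using (_∘_; flip)

infixl 9 _!_
_!_ : ∀ {m} → Subset m → Fin m → Bool
p ! i = lookup p i

true≢false : true ≢ false
true≢false ()

≢true⇒≡false : ∀ {b} → ¬ b ≡ true → b ≡ false
≢true⇒≡false = ¬-not

bool-⇔⇒≡ : ∀ {a b : Bool} → (a ≡ true → b ≡ true) → (b ≡ true → a ≡ true) → a ≡ b
bool-⇔⇒≡ {false} {false} _ _ = refl
bool-⇔⇒≡ {false} {true}  _ g = g refl
bool-⇔⇒≡ {true}  {false} f _ = sym (f refl)
bool-⇔⇒≡ {true}  {true}  _ _ = refl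

∧-true⁻ : ∀ {a b} → a ∧ b ≡ true → a ≡ true × b ≡ true
∧-true⁻ {true} {true} refl = refl , refl

∨-true⁻ : ∀ {a b} → a ∨ b ≡ true → a ≡ true ⊎ b ≡ true
∨-true⁻ {true}  _ = inj₁ refl
∨-true⁻ {false} h = inj₂ h

≗⇒≡ : ∀ {m} {p q : Subset m} → lookup p ≗ lookup q → p ≡ q
≗⇒≡ {p = p} {q} h = trans (sym (tabulate∘lookup p)) (trans (tabulate-cong h) (tabulate∘lookup q))

lookup-⊆ : ∀ {m} (p q : Subset m) → (∀ i → p ! i ≡ true → q ! i ≡ true) → p ⊆ q
lookup-⊆ p q h {x} x∈p = lookup⇒[]= x q (h x ([]=⇒lookup x∈p))

lookup-∪ : ∀ {m} (p q : Subset m) i → (p ∪ q) ! i ≡ p ! i ∨ q ! i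
lookup-∪ p q i = lookup-zipWith _∨_ i p q

lookup-∩ : ∀ {m} (p q : Subset m) i → (p ∩ q) ! i ≡ p ! i ∧ q ! i
lookup-∩ p q i = lookup-zipWith _∧_ i p q

lookup-─ : ∀ {m} (p q : Subset m) i → (p ─ q) ! i ≡ p ! i ∧ not (q ! i)
lookup-─ (x ∷ p) (true  ∷ q) zero    = sym (∧-zeroʳ x)
lookup-─ (x ∷ p) (false ∷ q) zero    = sym (∧-identityʳ x)
lookup-─ (x ∷ p) (y     ∷ q) (suc i) = lookup-─ p q i

lookup-⊥ : ∀ {m} (i : Fin m) → ⊥ ! i ≡ false
lookup-⊥ i = lookup-replicate i false

lookup-⁅x⁆ : ∀ {m} (x : Fin m) → ⁅ x ⁆ ! x ≡ true
lookup-⁅x⁆ zero    = refl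
lookup-⁅x⁆ (suc x) = lookup-⁅x⁆ x

lookup-⁅y⁆ : ∀ {m} {x : Fin m} (y : Fin m) → x ≢ y → ⁅ y ⁆ ! x ≡ false
lookup-⁅y⁆ {x = zero}  zero    x≢y = ⊥-elim (x≢y refl)
lookup-⁅y⁆ {x = suc x} zero    _   = lookup-⊥ x
lookup-⁅y⁆ {x = zero}  (suc y) _   = refl
lookup-⁅y⁆ {x = suc x} (suc y) x≢y = lookup-⁅y⁆ y (x≢y ∘ cong suc)

lookup-⁅y⁆⇒≡ : ∀ {m} {x : Fin m} (y : Fin m) → ⁅ y ⁆ ! x ≡ true → x ≡ y
lookup-⁅y⁆⇒≡ {x = x} y h with x Fin.≟ y
... | yes x≡y = x≡y
... | no  x≢y = ⊥-elim (true≢false (trans (sym h) (lookup-⁅y⁆ y x≢y)))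

⊥─p≡⊥ : ∀ {m} (p : Subset m) → ⊥ ─ p ≡ ⊥
⊥─p≡⊥ p = ≗⇒≡ {p = ⊥ ─ p} λ i →
  trans (lookup-─ ⊥ p i) (trans (cong (_∧ not (p ! i)) (lookup-⊥ i)) (sym (lookup-⊥ i)))

x∈p─q⁻ : ∀ {m} (p q : Subset m) i → (p ─ q) ! i ≡ true → p ! i ≡ true × q ! i ≡ false
x∈p─q⁻ p q i h with ∧-true⁻ {p ! i} (trans (sym (lookup-─ p q i)) h)
... | pᵢ , ¬qᵢ = pᵢ , ≢true⇒≡false λ qᵢ → true≢false (trans (sym ¬qᵢ) (cong not qᵢ))

x∈p─q⁺ : ∀ {m} (p q : Subset m) i → p ! i ≡ true → q ! i ≡ false → (p ─ q) ! i ≡ true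
x∈p─q⁺ p q i pᵢ qᵢ = trans (lookup-─ p q i) (cong₂ (λ a b → a ∧ not b) pᵢ qᵢ)

x∈p∪⁅x⁆ : ∀ {m} (p : Subset m) x → (p ∪ ⁅ x ⁆) ! x ≡ true
x∈p∪⁅x⁆ p x = trans (lookup-∪ p ⁅ x ⁆ x) (trans (cong (p ! x ∨_) (lookup-⁅x⁆ x)) (∨-zeroʳ _))

Empty-∩⁻ : ∀ {m} (p q : Subset m) → Empty (p ∩ q) → ∀ i → p ! i ≡ true → q ! i ≡ false
Empty-∩⁻ p q empty i pᵢ = ≢true⇒≡false λ qᵢ →
  empty (i , lookup⇒[]= i (p ∩ q) (trans (lookup-∩ p q i) (cong₂ _∧_ pᵢ qᵢ)))

Empty-∩⁺ : ∀ {m} (p q : Subset m) → (∀ i → p ! i ≡ true → q ! i ≡ false) → Empty (p ∩ q)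
Empty-∩⁺ p q apart (i , i∈p∩q) with ∧-true⁻ {p ! i} (trans (sym (lookup-∩ p q i)) ([]=⇒lookup i∈p∩q))
... | pᵢ , qᵢ = true≢false (trans (sym qᵢ) (apart i pᵢ))

Empty-∩⁻ʳ : ∀ {m} (p q : Subset m) → Empty (p ∩ q) → ∀ i → q ! i ≡ true → p ! i ≡ false
Empty-∩⁻ʳ p q empty i qᵢ = ≢true⇒≡false λ pᵢ → true≢false (trans (sym qᵢ) (Empty-∩⁻ p q empty i pᵢ))

∣p∪q∣≡∣p∣+∣q∣ : ∀ {m} (p q : Subset m) → (∀ i → p ! i ≡ true → q ! i ≡ true → ⊥₀)
              → ∣ p ∪ q ∣ ≡ ∣ p ∣ + ∣ q ∣
∣p∪q∣≡∣p∣+∣q∣ []          []          _ = refl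
∣p∪q∣≡∣p∣+∣q∣ (false ∷ p) (false ∷ q) h = ∣p∪q∣≡∣p∣+∣q∣ p q (h ∘ suc)
∣p∪q∣≡∣p∣+∣q∣ (false ∷ p) (true  ∷ q) h = trans (cong suc (∣p∪q∣≡∣p∣+∣q∣ p q (h ∘ suc))) (sym (+-suc _ _))
∣p∪q∣≡∣p∣+∣q∣ (true  ∷ p) (false ∷ q) h = cong suc (∣p∪q∣≡∣p∣+∣q∣ p q (h ∘ suc))
∣p∪q∣≡∣p∣+∣q∣ (true  ∷ p) (true  ∷ q) h = ⊥-elim (h zero refl refl)

∣p∣≡∣p∩q∣+∣p─q∣ : ∀ {m} (p q : Subset m) → ∣ p ∣ ≡ ∣ p ∩ q ∣ + ∣ p ─ q ∣
∣p∣≡∣p∩q∣+∣p─q∣ p q =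
  trans (cong ∣_∣ (≗⇒≡ {p = p} {q = (p ∩ q) ∪ (p ─ q)} split)) (∣p∪q∣≡∣p∣+∣q∣ (p ∩ q) (p ─ q) disjoint)
  where
  boolean-split : ∀ a b → a ≡ (a ∧ b) ∨ (a ∧ not b)
  boolean-split false _     = refl
  boolean-split true  false = refl
  boolean-split true  true  = refl
  split : ∀ i → p ! i ≡ ((p ∩ q) ∪ (p ─ q)) ! i
  split i = trans (boolean-split (p ! i) (q ! i))
                  (sym (trans (lookup-∪ (p ∩ q) (p ─ q) i) (cong₂ _∨_ (lookup-∩ p q i) (lookup-─ p q i))))
  disjoint : ∀ i → (p ∩ q) ! i ≡ true → (p ─ q) ! i ≡ true → ⊥₀
  disjoint i a b =
    true≢false (trans (sym (proj₂ (∧-true⁻ (trans (sym (lookup-∩ p q i)) a)))) (proj₂ (x∈p─q⁻ p q i b)))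

∣p∪⁅x⁆∣≡1+∣p∣ : ∀ {m} (p : Subset m) x → p ! x ≡ false → ∣ p ∪ ⁅ x ⁆ ∣ ≡ suc ∣ p ∣
∣p∪⁅x⁆∣≡1+∣p∣ p x x∉p =
  trans (∣p∪q∣≡∣p∣+∣q∣ p ⁅ x ⁆ disjoint) (trans (cong (∣ p ∣ +_) (∣⁅x⁆∣≡1 x)) (+-comm ∣ p ∣ 1))
  where
  disjoint : ∀ i → p ! i ≡ true → ⁅ x ⁆ ! i ≡ true → ⊥₀
  disjoint i pᵢ xᵢ with lookup-⁅y⁆⇒≡ x xᵢ
  ... | refl = true≢false (trans (sym pᵢ) x∉p)

p─q≡p─r : ∀ {m} (p q r : Subset m) → (∀ i → p ! i ≡ true → q ! i ≡ r ! i) → p ─ q ≡ p ─ r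
p─q≡p─r p q r h = ≗⇒≡ λ i → trans (lookup-─ p q i) (trans (agree i (p ! i) refl) (sym (lookup-─ p r i)))
  where
  agree : ∀ i b → p ! i ≡ b → b ∧ not (q ! i) ≡ b ∧ not (r ! i)
  agree i false _  = refl
  agree i true  pᵢ = cong not (h i pᵢ)

p∪⁅x⁆─q≡p─q : ∀ {m} (p q : Subset m) x → q ! x ≡ true → (p ∪ ⁅ x ⁆) ─ q ≡ p ─ q
p∪⁅x⁆─q≡p─q p q x x∈q = ≗⇒≡ λ i →
  trans (lookup-─ (p ∪ ⁅ x ⁆) q i) (trans (pointwise i) (sym (lookup-─ p q i)))
  where
  pointwise : ∀ i → (p ∪ ⁅ x ⁆) ! i ∧ not (q ! i) ≡ p ! i ∧ not (q ! i)
  pointwise i with i Fin.≟ x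
  ... | yes refl rewrite x∈q = trans (∧-zeroʳ _) (sym (∧-zeroʳ _))
  ... | no  i≢x  rewrite lookup-∪ p ⁅ x ⁆ i | lookup-⁅y⁆ x i≢x | ∨-identityʳ (p ! i) = refl

p∪⁅x⁆─q≡p─q∪⁅x⁆ : ∀ {m} (p q : Subset m) x → q ! x ≡ false → (p ∪ ⁅ x ⁆) ─ q ≡ (p ─ q) ∪ ⁅ x ⁆
p∪⁅x⁆─q≡p─q∪⁅x⁆ p q x x∉q = ≗⇒≡ λ i →
  trans (lookup-─ (p ∪ ⁅ x ⁆) q i) (trans (pointwise i) (sym (lookup-∪ (p ─ q) ⁅ x ⁆ i)))
  where
  pointwise : ∀ i → (p ∪ ⁅ x ⁆) ! i ∧ not (q ! i) ≡ (p ─ q) ! i ∨ ⁅ x ⁆ ! i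
  pointwise i with i Fin.≟ x
  ... | yes refl rewrite x∉q | x∈p∪⁅x⁆ p i | lookup-⁅x⁆ i | ∨-zeroʳ ((p ─ q) ! i) = refl
  ... | no  i≢x  rewrite lookup-∪ p ⁅ x ⁆ i | lookup-⁅y⁆ x i≢x | ∨-identityʳ (p ! i)
                       | ∨-identityʳ ((p ─ q) ! i) = sym (lookup-─ p q i)

∣p∪⁅x⁆─q∣≡1+∣p─q∣ : ∀ {m} (p q : Subset m) x → p ! x ≡ false → q ! x ≡ false
                   → ∣ (p ∪ ⁅ x ⁆) ─ q ∣ ≡ suc ∣ p ─ q ∣
∣p∪⁅x⁆─q∣≡1+∣p─q∣ p q x x∉p x∉q = trans (cong ∣_∣ (p∪⁅x⁆─q≡p─q∪⁅x⁆ p q x x∉q))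
  (∣p∪⁅x⁆∣≡1+∣p∣ (p ─ q) x (trans (lookup-─ p q x) (cong (_∧ not (q ! x)) x∉p)))

p─⁅x⁆∪⁅x⁆≡p : ∀ {m} (p : Subset m) x → p ! x ≡ true → (p ─ ⁅ x ⁆) ∪ ⁅ x ⁆ ≡ p
p─⁅x⁆∪⁅x⁆≡p p x x∈p = ≗⇒≡ λ i → trans (lookup-∪ (p ─ ⁅ x ⁆) ⁅ x ⁆ i) (pointwise i)
  where
  pointwise : ∀ i → (p ─ ⁅ x ⁆) ! i ∨ ⁅ x ⁆ ! i ≡ p ! i
  pointwise i with i Fin.≟ x
  ... | yes refl rewrite lookup-⁅x⁆ i | x∈p = ∨-zeroʳ _
  ... | no  i≢x  rewrite lookup-─ p ⁅ x ⁆ i | lookup-⁅y⁆ x i≢x | ∨-identityʳ (p ! i ∧ true) = ∧-identityʳ _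

∣p─q∣≤∣p∪r─q∣ : ∀ {m} (p q r : Subset m) → ∣ p ─ q ∣ ≤ ∣ (p ∪ r) ─ q ∣
∣p─q∣≤∣p∪r─q∣ p q r = p⊆q⇒∣p∣≤∣q∣ (lookup-⊆ (p ─ q) ((p ∪ r) ─ q) λ i h →
  let pᵢ , qᵢ = x∈p─q⁻ p q i h
  in x∈p─q⁺ (p ∪ r) q i (trans (lookup-∪ p r i) (cong (_∨ r ! i) pᵢ)) qᵢ)

lookup-⋃⁻ : ∀ {m} (Ss : List (Subset m)) i → ⋃ Ss ! i ≡ true → Any (λ S → S ! i ≡ true) Ss
lookup-⋃⁻ []       i h = ⊥-elim (true≢false (trans (sym h) (lookup-⊥ i)))
lookup-⋃⁻ (S ∷ Ss) i h with ∨-true⁻ {S ! i} (trans (sym (lookup-∪ S (⋃ Ss) i)) h)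
... | inj₁ Sᵢ   = here Sᵢ
... | inj₂ rest = there (lookup-⋃⁻ Ss i rest)

lookup-⋃⁺ : ∀ {m} (Ss : List (Subset m)) i → Any (λ S → S ! i ≡ true) Ss → ⋃ Ss ! i ≡ true
lookup-⋃⁺ (S ∷ Ss) i (here Sᵢ)  = trans (lookup-∪ S (⋃ Ss) i) (cong (_∨ ⋃ Ss ! i) Sᵢ)
lookup-⋃⁺ (S ∷ Ss) i (there h) =
  trans (lookup-∪ S (⋃ Ss) i) (trans (cong (S ! i ∨_) (lookup-⋃⁺ Ss i h)) (∨-zeroʳ (S ! i)))

unionOver⁻ : ∀ {n m} (W : Fin n → Subset m) A i → unionOver W A ! i ≡ true
           → ∃ λ f → A ! f ≡ true × W f ! i ≡ true
unionOver⁻ {n} W A i h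
  with satisfied (map⁻ {f = λ f → if A ! f then W f else ⊥} {xs = allFin n} (lookup-⋃⁻ _ i h))
... | f , member = f , selected (A ! f) member
  where
  selected : ∀ b → (if b then W f else ⊥) ! i ≡ true → b ≡ true × W f ! i ≡ true
  selected true  Wᵢ = refl , Wᵢ
  selected false ⊥ᵢ = ⊥-elim (true≢false (trans (sym ⊥ᵢ) (lookup-⊥ i)))

unionOver⁺ : ∀ {n m} (W : Fin n → Subset m) A i f → A ! f ≡ true → W f ! i ≡ true
           → unionOver W A ! i ≡ true
unionOver⁺ W A i f f∈A Wᵢ = lookup-⋃⁺ _ i (map⁺ (lose (∈-allFin f) member))
  where
  member : (if A ! f then W f else ⊥) ! i ≡ true
  member rewrite f∈A = Wᵢ

unionOver-mono : ∀ {n m} (W : Fin n → Subset m) A B → (∀ g → A ! g ≡ true → B ! g ≡ true)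
               → ∀ i → unionOver W A ! i ≡ true → unionOver W B ! i ≡ true
unionOver-mono W A B A⊆B i h = let g , g∈A , Wᵢ = unionOver⁻ W A i h in unionOver⁺ W B i g (A⊆B g g∈A) Wᵢ

lookup-unionOver-cong : ∀ {n m} {W W′ : Fin n → Subset m} A i → (∀ g → W g ! i ≡ W′ g ! i)
                      → unionOver W A ! i ≡ unionOver W′ A ! i
lookup-unionOver-cong {W = W} {W′} A i eq = bool-⇔⇒≡
  (λ h → let g , g∈A , Wᵢ = unionOver⁻ W A i h in unionOver⁺ W′ A i g g∈A (trans (sym (eq g)) Wᵢ))
  (λ h → let g , g∈A , W′ᵢ = unionOver⁻ W′ A i h in unionOver⁺ W A i g g∈A (trans (eq g) W′ᵢ))

minSub-≤ : ∀ n (h : Subset n → ℕ) A → minSub n h ≤ h A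
minSub-≤ zero    h []          = ≤-refl
minSub-≤ (suc n) h (false ∷ A) = ≤-trans (m⊓n≤m _ _) (minSub-≤ n _ A)
minSub-≤ (suc n) h (true  ∷ A) = ≤-trans (m⊓n≤n _ _) (minSub-≤ n _ A)

minSub-attained : ∀ n (h : Subset n → ℕ) → ∃ λ A → minSub n h ≡ h A
minSub-attained zero    h = [] , refl
minSub-attained (suc n) h with ⊓-sel (minSub n (h ∘ (false ∷_))) (minSub n (h ∘ (true ∷_)))
... | inj₁ p = let A , q = minSub-attained n (h ∘ (false ∷_)) in false ∷ A , trans p q
... | inj₂ p = let A , q = minSub-attained n (h ∘ (true ∷_))  in true ∷ A , trans p q

minSub-greatest : ∀ n (h : Subset n → ℕ) k → (∀ A → k ≤ h A) → k ≤ minSub n h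
minSub-greatest n h k k≤h = let A , q = minSub-attained n h in subst (k ≤_) (sym q) (k≤h A)

minSub-≡ : ∀ n (h : Subset n → ℕ) k A → h A ≤ k → (∀ B → k ≤ h B) → minSub n h ≡ k
minSub-≡ n h k A hA≤k k≤h = ≤-antisym (≤-trans (minSub-≤ n h A) hA≤k) (minSub-greatest n h k k≤h)

minSub-cong : ∀ n {h h′ : Subset n → ℕ} → h ≗ h′ → minSub n h ≡ minSub n h′
minSub-cong zero    eq = eq []
minSub-cong (suc n) eq = cong₂ _⊓_ (minSub-cong n (eq ∘ (false ∷_))) (minSub-cong n (eq ∘ (true ∷_)))

natRank-cong : ∀ {n m} (ρ : Subset n → ℕ) {W W′ : Fin n → Subset m} → (∀ f i → W f ! i ≡ W′ f ! i)
             → natRank ρ W ≗ natRank ρ W′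
natRank-cong {n} ρ eq Z = minSub-cong n λ A →
  cong (λ S → ρ A + ∣ Z ─ S ∣) (≗⇒≡ λ i → lookup-unionOver-cong A i (λ g → eq g i))

e-or-punchIn : ∀ {n} (e i : Fin (suc n)) → i ≡ e ⊎ ∃ λ g → i ≡ punchIn e g
e-or-punchIn e i with e Fin.≟ i
... | yes e≡i = inj₁ (sym e≡i)
... | no  e≢i = inj₂ (punchOut e≢i , sym (Fin.punchIn-punchOut e≢i))

≡insertAt : ∀ {n} (e : Fin (suc n)) (p : Subset (suc n)) {A : Subset n} {b : Bool}
          → p ! e ≡ b → (∀ g → p ! punchIn e g ≡ A ! g) → p ≡ insertAt A e b
≡insertAt e p {A} {b} pₑ p∘punchIn = ≗⇒≡ λ i → pointwise i (e-or-punchIn e i)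
  where
  pointwise : ∀ i → i ≡ e ⊎ ∃ (λ g → i ≡ punchIn e g) → p ! i ≡ insertAt A e b ! i
  pointwise _ (inj₁ refl)       = trans pₑ (sym (insertAt-lookup A e b))
  pointwise _ (inj₂ (g , refl)) = trans (p∘punchIn g) (sym (insertAt-punchIn A e b g))

insertAt-∪ : ∀ {n} (e : Fin (suc n)) (A C : Subset n) b c
           → insertAt A e b ∪ insertAt C e c ≡ insertAt (A ∪ C) e (b ∨ c)
insertAt-∪ e A C b c = ≡insertAt e (Aᵇ ∪ Cᶜ)
  (trans (lookup-∪ Aᵇ Cᶜ e) (cong₂ _∨_ (insertAt-lookup A e b) (insertAt-lookup C e c)))
  (λ g → trans (lookup-∪ Aᵇ Cᶜ (punchIn e g))
               (trans (cong₂ _∨_ (insertAt-punchIn A e b g) (insertAt-punchIn C e c g))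
                      (sym (lookup-∪ A C g))))
  where
  Aᵇ = insertAt A e b
  Cᶜ = insertAt C e c

liftSub∪⁅e⁆ : ∀ {n} (e : Fin (suc n)) A → liftSub e A ∪ ⁅ e ⁆ ≡ insertAt A e true
liftSub∪⁅e⁆ e A = ≡insertAt e (liftSub e A ∪ ⁅ e ⁆)
  (trans (lookup-∪ (liftSub e A) ⁅ e ⁆ e) (trans (cong (liftSub e A ! e ∨_) (lookup-⁅x⁆ e)) (∨-zeroʳ _)))
  (λ g → trans (lookup-∪ (liftSub e A) ⁅ e ⁆ (punchIn e g))
               (trans (cong₂ _∨_ (insertAt-punchIn A e false g) (lookup-⁅y⁆ e (Fin.punchInᵢ≢i e g)))
                      (∨-identityʳ (A ! g))))

liftSub⁅g⁆ : ∀ {n} (e : Fin (suc n)) g → liftSub e ⁅ g ⁆ ≡ ⁅ punchIn e g ⁆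
liftSub⁅g⁆ e g = sym (≡insertAt e ⁅ punchIn e g ⁆ (lookup-⁅y⁆ _ (Fin.punchInᵢ≢i e g ∘ sym)) at-punchIn)
  where
  at-punchIn : ∀ h → ⁅ punchIn e g ⁆ ! punchIn e h ≡ ⁅ g ⁆ ! h
  at-punchIn h with h Fin.≟ g
  ... | yes refl = trans (lookup-⁅x⁆ (punchIn e h)) (sym (lookup-⁅x⁆ h))
  ... | no  h≢g  = trans (lookup-⁅y⁆ _ (h≢g ∘ Fin.punchIn-injective e h g)) (sym (lookup-⁅y⁆ g h≢g))

-- Compression

subadditive : ∀ {n} {ρ : Subset n → ℕ} → IsPolymatroid ρ → ∀ A B → ρ (A ∪ B) ≤ ρ A + ρ B
subadditive {ρ = ρ} poly A B = m+n≤o⇒m≤o (ρ (A ∪ B)) (IsPolymatroid.submodular poly A B)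

decrementIf : Bool → ℕ → ℕ
decrementIf b x = if b then x ∸ 1 else x

module Compression {n : ℕ} (ρ : Subset (suc n) → ℕ) (e : Fin (suc n))
                   (poly : IsPolymatroid ρ) (ρe>0 : 0 < ρ ⁅ e ⁆) where

  open IsPolymatroid poly

  ρ⁺ ρ⁻ : Subset n → ℕ
  ρ⁺ A = ρ (insertAt A e true)
  ρ⁻ A = ρ (insertAt A e false)

  ρ⁻≤ρ⁺ : ∀ A → ρ⁻ A ≤ ρ⁺ A
  ρ⁻≤ρ⁺ A = monotone _ _
    (lookup-⊆ (insertAt A e false) (insertAt A e true) λ i → pointwise i (e-or-punchIn e i))
    where
    pointwise : ∀ i → i ≡ e ⊎ ∃ (λ g → i ≡ punchIn e g)
              → insertAt A e false ! i ≡ true → insertAt A e true ! i ≡ true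
    pointwise _ (inj₁ refl)       _ = insertAt-lookup A e true
    pointwise _ (inj₂ (g , refl)) h =
      trans (insertAt-punchIn A e true g) (trans (sym (insertAt-punchIn A e false g)) h)

  e∈⇒0<ρ : ∀ B → B ! e ≡ true → 0 < ρ B
  e∈⇒0<ρ B eₑ = ≤-trans ρe>0 (monotone _ _ (lookup-⊆ ⁅ e ⁆ B λ i h →
    subst (λ j → B ! j ≡ true) (sym (lookup-⁅y⁆⇒≡ e h)) eₑ))

  compress-unfold : ∀ A → compress ρ e A ≡ decrementIf (does (ρ⁺ A ≟ ρ⁻ A)) (ρ⁻ A)
  compress-unfold A = cong (λ S → decrementIf (does (ρ S ≟ ρ⁻ A)) (ρ⁻ A)) (liftSub∪⁅e⁆ e A)

  compress-cases : ∀ A → (ρ⁺ A ≡ ρ⁻ A × compress ρ e A ≡ ρ⁻ A ∸ 1) ⊎ (ρ⁺ A ≢ ρ⁻ A × compress ρ e A ≡ ρ⁻ A)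
  compress-cases A with ρ⁺ A ≟ ρ⁻ A
  ... | yes eq = inj₁ (eq , trans (compress-unfold A) (cong (flip decrementIf (ρ⁻ A)) (dec-true (_ ≟ _) eq)))
  ... | no  ne = inj₂ (ne , trans (compress-unfold A) (cong (flip decrementIf (ρ⁻ A)) (dec-false (_ ≟ _) ne)))

  compress-collapse : ∀ A → ρ⁺ A ≡ ρ⁻ A → compress ρ e A ≡ ρ⁻ A ∸ 1 → suc (compress ρ e A) ≡ ρ⁺ A
  compress-collapse A eq c≡ = begin
    suc (compress ρ e A) ≡⟨ cong suc c≡ ⟩
    suc (ρ⁻ A ∸ 1)       ≡⟨ cong (λ x → suc (x ∸ 1)) (sym eq) ⟩
    suc (ρ⁺ A ∸ 1)       ≡⟨ suc-pred (ρ⁺ A) {{>-nonZero (e∈⇒0<ρ _ (insertAt-lookup A e true))}} ⟩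
    ρ⁺ A                 ∎
    where open ≡-Reasoning

  compress<ρ⁺ : ∀ A → suc (compress ρ e A) ≤ ρ⁺ A
  compress<ρ⁺ A with compress-cases A
  ... | inj₁ (eq , c≡) = ≤-reflexive (compress-collapse A eq c≡)
  ... | inj₂ (ne , c≡) rewrite c≡ = ≤∧≢⇒< (ρ⁻≤ρ⁺ A) (ne ∘ sym)

  compress≤ρ⁻ : ∀ A → compress ρ e A ≤ ρ⁻ A
  compress≤ρ⁻ A with compress-cases A
  ... | inj₁ (_ , c≡) rewrite c≡ = pred[n]≤n
  ... | inj₂ (_ , c≡) rewrite c≡ = ≤-refl

  compress-tight : ∀ A → suc (compress ρ e A) ≡ ρ⁺ A ⊎ compress ρ e A ≡ ρ⁻ A
  compress-tight A with compress-cases A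
  ... | inj₁ (eq , c≡) = inj₁ (compress-collapse A eq c≡)
  ... | inj₂ (_  , c≡) = inj₂ c≡

  compress-⊥ : compress ρ e ⊥ ≡ 0
  compress-⊥ = n≤0⇒n≡0 (≤-trans (compress≤ρ⁻ ⊥) (≤-reflexive (trans (cong ρ (sym ⊥≡insertAt)) normalized)))
    where
    ⊥≡insertAt : ⊥ ≡ insertAt ⊥ e false
    ⊥≡insertAt = ≡insertAt e ⊥ (lookup-⊥ e) (λ g → trans (lookup-⊥ (punchIn e g)) (sym (lookup-⊥ g)))

  ρ-insertAt-∪ : ∀ A C b c → ρ (insertAt (A ∪ C) e (b ∨ c)) ≤ ρ (insertAt A e b) + ρ (insertAt C e c)
  ρ-insertAt-∪ A C b c =
    subst (λ S → ρ S ≤ ρ (insertAt A e b) + ρ (insertAt C e c)) (insertAt-∪ e A C b c) (subadditive poly _ _)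

  compress-subadditive : ∀ A C → compress ρ e (A ∪ C) ≤ compress ρ e A + compress ρ e C
  compress-subadditive A C with compress-tight A | compress-tight C
  -- e ∈ A⁺ ∩ C⁺, so the intersection term of submodularity pays for the second lost unit
  ... | inj₁ cA | inj₁ cC = s≤s⁻¹ (s≤s⁻¹ (begin
    suc (suc (compress ρ e (A ∪ C)))            ≡⟨ cong suc (+-comm 1 _) ⟩
    suc (compress ρ e (A ∪ C)) + 1              ≤⟨ +-mono-≤ (compress<ρ⁺ (A ∪ C)) (e∈⇒0<ρ _ e∈A⁺∩C⁺) ⟩
    ρ⁺ (A ∪ C) + ρ (A⁺ ∩ C⁺)                    ≡⟨ cong (λ S → ρ S + ρ (A⁺ ∩ C⁺)) (sym A⁺∪C⁺≡) ⟩
    ρ (A⁺ ∪ C⁺) + ρ (A⁺ ∩ C⁺)                   ≤⟨ submodular A⁺ C⁺ ⟩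
    ρ⁺ A + ρ⁺ C                                 ≡⟨ cong₂ _+_ (sym cA) (sym cC) ⟩
    suc (compress ρ e A) + suc (compress ρ e C) ≡⟨ cong suc (+-suc _ _) ⟩
    suc (suc (compress ρ e A + compress ρ e C)) ∎))
    where
    open ≤-Reasoning
    A⁺ = insertAt A e true
    C⁺ = insertAt C e true
    A⁺∪C⁺≡ = insertAt-∪ e A C true true
    e∈A⁺∩C⁺ : (A⁺ ∩ C⁺) ! e ≡ true
    e∈A⁺∩C⁺ = trans (lookup-∩ A⁺ C⁺ e) (cong₂ _∧_ (insertAt-lookup A e true) (insertAt-lookup C e true))
  ... | inj₁ cA | inj₂ cC = s≤s⁻¹ (begin
    suc (compress ρ e (A ∪ C))             ≤⟨ compress<ρ⁺ (A ∪ C) ⟩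
    ρ⁺ (A ∪ C)                             ≤⟨ ρ-insertAt-∪ A C true false ⟩
    ρ⁺ A + ρ⁻ C                            ≡⟨ cong₂ _+_ (sym cA) (sym cC) ⟩
    suc (compress ρ e A + compress ρ e C)  ∎)
    where open ≤-Reasoning
  ... | inj₂ cA | inj₁ cC = s≤s⁻¹ (begin
    suc (compress ρ e (A ∪ C))             ≤⟨ compress<ρ⁺ (A ∪ C) ⟩
    ρ⁺ (A ∪ C)                             ≤⟨ ρ-insertAt-∪ A C false true ⟩
    ρ⁻ A + ρ⁺ C                            ≡⟨ cong₂ _+_ (sym cA) (sym cC) ⟩
    compress ρ e A + suc (compress ρ e C)  ≡⟨ +-suc _ _ ⟩
    suc (compress ρ e A + compress ρ e C)  ∎)
    where open ≤-Reasoning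
  ... | inj₂ cA | inj₂ cC = begin
    compress ρ e (A ∪ C)            ≤⟨ compress≤ρ⁻ (A ∪ C) ⟩
    ρ⁻ (A ∪ C)                      ≤⟨ ρ-insertAt-∪ A C false false ⟩
    ρ⁻ A + ρ⁻ C                     ≡⟨ cong₂ _+_ (sym cA) (sym cC) ⟩
    compress ρ e A + compress ρ e C ∎
    where open ≤-Reasoning

-- Contracting an element of X_e

module Contraction {n m : ℕ} (ρ : Subset (suc n) → ℕ) (e : Fin (suc n))
                   (poly : IsPolymatroid ρ) (ρe>0 : 0 < ρ ⁅ e ⁆)
                   (V : Fin (suc n) → Subset m) (V′ : Fin n → Subset m) (e₁ : Fin m)
                   (e₁∈Vₑ : V e ! e₁ ≡ true) (e₁∉V : ∀ g → V (punchIn e g) ! e₁ ≡ false) where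

  open Compression ρ e poly ρe>0

  Compatible : Subset m → Set
  Compatible Z = ∀ i → Z ! i ≡ true → V e ! i ≡ false × (∀ g → V′ g ! i ≡ V (punchIn e g) ! i)

  unionOver-insertAt-e₁ : ∀ A b → unionOver V (insertAt A e b) ! e₁ ≡ b
  unionOver-insertAt-e₁ A b = bool-⇔⇒≡ to from
    where
    to : unionOver V (insertAt A e b) ! e₁ ≡ true → b ≡ true
    to h with unionOver⁻ V (insertAt A e b) e₁ h
    ... | f , f∈A , Vᵢ with e-or-punchIn e f
    ...   | inj₁ refl       = trans (sym (insertAt-lookup A e b)) f∈A
    ...   | inj₂ (g , refl) = ⊥-elim (true≢false (trans (sym Vᵢ) (e₁∉V g)))
    from : b ≡ true → unionOver V (insertAt A e b) ! e₁ ≡ true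
    from b≡true = unionOver⁺ V (insertAt A e b) e₁ e (trans (insertAt-lookup A e b) b≡true) e₁∈Vₑ

  module _ (Z : Subset m) (compatible : Compatible Z) where

    unionOver-insertAt : ∀ A b i → Z ! i ≡ true → unionOver V (insertAt A e b) ! i ≡ unionOver V′ A ! i
    unionOver-insertAt A b i Zᵢ = bool-⇔⇒≡ to from
      where
      Vₑᵢ≡false = proj₁ (compatible i Zᵢ)
      V′≡V      = proj₂ (compatible i Zᵢ)
      to : unionOver V (insertAt A e b) ! i ≡ true → unionOver V′ A ! i ≡ true
      to h with unionOver⁻ V (insertAt A e b) i h
      ... | f , f∈A , Vᵢ with e-or-punchIn e f
      ...   | inj₁ refl       = ⊥-elim (true≢false (trans (sym Vᵢ) Vₑᵢ≡false))
      ...   | inj₂ (g , refl) =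
        unionOver⁺ V′ A i g (trans (sym (insertAt-punchIn A e b g)) f∈A) (trans (V′≡V g) Vᵢ)
      from : unionOver V′ A ! i ≡ true → unionOver V (insertAt A e b) ! i ≡ true
      from h with unionOver⁻ V′ A i h
      ... | g , g∈A , V′ᵢ = unionOver⁺ V (insertAt A e b) i (punchIn e g)
                              (trans (insertAt-punchIn A e b g) g∈A) (trans (sym (V′≡V g)) V′ᵢ)

    e₁∉Z : Z ! e₁ ≡ false
    e₁∉Z = ≢true⇒≡false λ e₁∈Z → true≢false (trans (sym e₁∈Vₑ) (proj₁ (compatible e₁ e₁∈Z)))

    Z─V≡Z─V′ : ∀ A b → Z ─ unionOver V (insertAt A e b) ≡ Z ─ unionOver V′ A
    Z─V≡Z─V′ A b = p─q≡p─r Z _ _ (unionOver-insertAt A b)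

    deficiency-with-e : ∀ A → ∣ (Z ∪ ⁅ e₁ ⁆) ─ unionOver V (insertAt A e true) ∣ ≡ ∣ Z ─ unionOver V′ A ∣
    deficiency-with-e A = cong ∣_∣ (trans (p∪⁅x⁆─q≡p─q Z _ e₁ (unionOver-insertAt-e₁ A true))
                                         (Z─V≡Z─V′ A true))

    deficiency-without-e : ∀ A
      → ∣ (Z ∪ ⁅ e₁ ⁆) ─ unionOver V (insertAt A e false) ∣ ≡ suc ∣ Z ─ unionOver V′ A ∣
    deficiency-without-e A = begin
      ∣ (Z ∪ ⁅ e₁ ⁆) ─ V₋ ∣  ≡⟨ ∣p∪⁅x⁆─q∣≡1+∣p─q∣ Z V₋ e₁ e₁∉Z (unionOver-insertAt-e₁ A false) ⟩
      suc ∣ Z ─ V₋ ∣          ≡⟨ cong (suc ∘ ∣_∣) (Z─V≡Z─V′ A false) ⟩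
      suc ∣ Z ─ unionOver V′ A ∣ ∎
      where
      open ≡-Reasoning
      V₋ = unionOver V (insertAt A e false)

    natRank-∪⁅e₁⁆ : natRank ρ V (Z ∪ ⁅ e₁ ⁆) ≡ suc (natRank (compress ρ e) V′ Z)
    natRank-∪⁅e₁⁆ = minSub-≡ (suc n) rankTerm (suc minimum) (proj₁ attained) (proj₂ attained) bounded
      where
      rankTerm : Subset (suc n) → ℕ
      rankTerm B = ρ B + ∣ (Z ∪ ⁅ e₁ ⁆) ─ unionOver V B ∣
      compressedTerm : Subset n → ℕ
      compressedTerm A = compress ρ e A + ∣ Z ─ unionOver V′ A ∣
      minimum = minSub n compressedTerm

      bounded-insertAt : ∀ A b → suc minimum ≤ rankTerm (insertAt A e b)
      bounded-insertAt A true = begin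
        suc minimum                                   ≤⟨ s≤s (minSub-≤ n compressedTerm A) ⟩
        suc (compressedTerm A)                        ≤⟨ +-monoˡ-≤ _ (compress<ρ⁺ A) ⟩
        ρ⁺ A + ∣ Z ─ unionOver V′ A ∣                 ≡⟨ cong (ρ⁺ A +_) (sym (deficiency-with-e A)) ⟩
        rankTerm (insertAt A e true)                  ∎
        where open ≤-Reasoning
      bounded-insertAt A false = begin
        suc minimum                                   ≤⟨ s≤s (minSub-≤ n compressedTerm A) ⟩
        suc (compressedTerm A)                        ≡⟨ sym (+-suc _ _) ⟩
        compress ρ e A + suc ∣ Z ─ unionOver V′ A ∣   ≤⟨ +-monoˡ-≤ _ (compress≤ρ⁻ A) ⟩
        ρ⁻ A + suc ∣ Z ─ unionOver V′ A ∣             ≡⟨ cong (ρ⁻ A +_) (sym (deficiency-without-e A)) ⟩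
        rankTerm (insertAt A e false)                 ∎
        where open ≤-Reasoning

      bounded : ∀ B → suc minimum ≤ rankTerm B
      bounded B = subst (λ B′ → suc minimum ≤ rankTerm B′) (insertAt-removeAt B e)
                        (bounded-insertAt (removeAt B e) (B ! e))

      attained : ∃ λ B → rankTerm B ≤ suc minimum
      attained with minSub-attained n compressedTerm
      ... | A₀ , min≡ with compress-tight A₀
      ... | inj₁ c≡ = insertAt A₀ e true , ≤-reflexive (begin
        rankTerm (insertAt A₀ e true)                   ≡⟨ cong₂ _+_ (sym c≡) (deficiency-with-e A₀) ⟩
        suc (compressedTerm A₀)                         ≡⟨ cong suc (sym min≡) ⟩
        suc minimum                                     ∎)
        where open ≡-Reasoning
      ... | inj₂ c≡ = insertAt A₀ e false , ≤-reflexive (begin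
        rankTerm (insertAt A₀ e false)                  ≡⟨ cong₂ _+_ (sym c≡) (deficiency-without-e A₀) ⟩
        compress ρ e A₀ + suc ∣ Z ─ unionOver V′ A₀ ∣   ≡⟨ +-suc _ _ ⟩
        suc (compressedTerm A₀)                         ≡⟨ cong suc (sym min≡) ⟩
        suc minimum                                     ∎)
        where open ≡-Reasoning

  ⊥-compatible : Compatible ⊥
  ⊥-compatible i ⊥ᵢ = ⊥-elim (true≢false (trans (sym ⊥ᵢ) (lookup-⊥ i)))

  natRank-compress-⊥ : natRank (compress ρ e) V′ ⊥ ≡ 0
  natRank-compress-⊥ = n≤0⇒n≡0 (≤-trans (minSub-≤ n _ ⊥) (≤-reflexive (cong₂ _+_ compress-⊥ ∣⊥─q∣≡0)))
    where
    ∣⊥─q∣≡0 : ∣ ⊥ ─ unionOver V′ ⊥ ∣ ≡ 0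
    ∣⊥─q∣≡0 = trans (cong ∣_∣ (⊥─p≡⊥ (unionOver V′ ⊥))) (∣⊥∣≡0 m)

  natRank-⁅e₁⁆ : natRank ρ V ⁅ e₁ ⁆ ≡ 1
  natRank-⁅e₁⁆ = begin
    natRank ρ V ⁅ e₁ ⁆                  ≡⟨ cong (natRank ρ V) (sym (∪-identityˡ ⁅ e₁ ⁆)) ⟩
    natRank ρ V (⊥ ∪ ⁅ e₁ ⁆)            ≡⟨ natRank-∪⁅e₁⁆ ⊥ ⊥-compatible ⟩
    suc (natRank (compress ρ e) V′ ⊥)   ≡⟨ cong suc natRank-compress-⊥ ⟩
    1                                   ∎
    where open ≡-Reasoning

  contraction : ∀ Z → Compatible Z → natRank (compress ρ e) V′ Z ≡ contractRank (natRank ρ V) ⁅ e₁ ⁆ Z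
  contraction Z compatible = sym (cong₂ _∸_ (natRank-∪⁅e₁⁆ Z compatible) natRank-⁅e₁⁆)

-- Closure and principal extensions

does-true⁻ : ∀ {P : Set} (d : Dec P) → does d ≡ true → P
does-true⁻ (yes p) _ = p

foldr-∧≡true⁻ : ∀ {A : Set} (p : A → Bool) xs → List.foldr (λ x b → p x ∧ b) true xs ≡ true
              → All (λ x → p x ≡ true) xs
foldr-∧≡true⁻ p []       _ = []
foldr-∧≡true⁻ p (x ∷ xs) h = let px , rest = ∧-true⁻ {p x} h in px ∷ foldr-∧≡true⁻ p xs rest

foldr-∧≡true⁺ : ∀ {A : Set} (p : A → Bool) xs → All (λ x → p x ≡ true) xs
              → List.foldr (λ x b → p x ∧ b) true xs ≡ true
foldr-∧≡true⁺ p []       []         = refl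
foldr-∧≡true⁺ p (x ∷ xs) (px ∷ pxs) = cong₂ _∧_ px (foldr-∧≡true⁺ p xs pxs)

implies-true⁻ : ∀ {b c} → (if b then c else true) ≡ true → b ≡ true → c ≡ true
implies-true⁻ {true} h _ = h

implies-true⁺ : ∀ {b c} → (b ≡ true → c ≡ true) → (if b then c else true) ≡ true
implies-true⁺ {true}  h = h refl
implies-true⁺ {false} _ = refl

module _ {m : ℕ} (r : Subset m → ℕ) (Z S : Subset m) where

  subsetClosure⁻ : subsetClosure r Z S ≡ true → ∀ x → S ! x ≡ true → r (Z ∪ ⁅ x ⁆) ≡ r Z
  subsetClosure⁻ h x Sₓ = does-true⁻ (r (Z ∪ ⁅ x ⁆) ≟ r Z)
    (implies-true⁻ (All.lookup (foldr-∧≡true⁻ _ (allFin m) h) (∈-allFin x)) Sₓ)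

  subsetClosure⁺ : (∀ x → S ! x ≡ true → r (Z ∪ ⁅ x ⁆) ≡ r Z) → subsetClosure r Z S ≡ true
  subsetClosure⁺ closed = foldr-∧≡true⁺ _ (allFin m)
    (All.tabulate λ {x} _ → implies-true⁺ λ Sₓ → dec-true (r (Z ∪ ⁅ x ⁆) ≟ r Z) (closed x Sₓ))

subsetClosure-cong : ∀ {m} {r r′ : Subset m → ℕ} → r ≗ r′ → ∀ Z S → subsetClosure r Z S ≡ subsetClosure r′ Z S
subsetClosure-cong {r = r} {r′} eq Z S = bool-⇔⇒≡
  (λ h → subsetClosure⁺ r′ Z S λ x Sₓ → trans (sym (eq _)) (trans (subsetClosure⁻ r Z S h x Sₓ) (eq Z)))
  (λ h → subsetClosure⁺ r Z S λ x Sₓ → trans (eq _) (trans (subsetClosure⁻ r′ Z S h x Sₓ) (sym (eq Z))))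

principalExt-cong : ∀ {m} {r r′ : Subset m → ℕ} → r ≗ r′ → ∀ u S → principalExt r u S ≗ principalExt r′ u S
principalExt-cong eq u S Z = cong₂ (λ a b → if Z ! u then a else b)
  (cong₂ (λ a c → a + (if c then 0 else 1)) (eq (Z ─ ⁅ u ⁆)) (subsetClosure-cong eq (Z ─ ⁅ u ⁆) S)) (eq Z)


module PrincipalExtension {n m : ℕ} (ρ : Subset n → ℕ) (W W′ : Fin n → Subset m)
         (u : Fin m) (f₀ : Fin n) (S : Subset m)
         (W′≡W : ∀ g i → i ≢ u → W′ g ! i ≡ W g ! i)
         (u∈W′f₀ : W′ f₀ ! u ≡ true)
         (u∉W′ : ∀ g → g ≢ f₀ → W′ g ! u ≡ false)
         (S⊆Wf₀ : ∀ i → S ! i ≡ true → W f₀ ! i ≡ true)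
         (S∉W : ∀ g → g ≢ f₀ → ∀ i → S ! i ≡ true → W g ! i ≡ false)
         (ρ-bound : ∀ A → ρ (A ∪ ⁅ f₀ ⁆) ≤ ρ A + ∣ S ∣) where

  r : Subset m → ℕ
  r = natRank ρ W

  term term′ : Subset m → Subset n → ℕ
  term  Z A = ρ A + ∣ Z ─ unionOver W A ∣
  term′ Z A = ρ A + ∣ Z ─ unionOver W′ A ∣

  lookup-unionOver-W′-u : ∀ A → unionOver W′ A ! u ≡ A ! f₀
  lookup-unionOver-W′-u A = bool-⇔⇒≡ to (λ f₀∈A → unionOver⁺ W′ A u f₀ f₀∈A u∈W′f₀)
    where
    to : unionOver W′ A ! u ≡ true → A ! f₀ ≡ true
    to h with unionOver⁻ W′ A u h
    ... | g , g∈A , W′ᵤ with g Fin.≟ f₀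
    ...   | yes refl = g∈A
    ...   | no  g≢f₀ = ⊥-elim (true≢false (trans (sym W′ᵤ) (u∉W′ g g≢f₀)))

  S∩unionOver : ∀ A x → A ! f₀ ≡ false → S ! x ≡ true → unionOver W A ! x ≡ false
  S∩unionOver A x f₀∉A Sₓ = ≢true⇒≡false λ h →
    let g , g∈A , Wₓ = unionOver⁻ W A x h in
    case-f₀ g g∈A Wₓ (g Fin.≟ f₀)
    where
    case-f₀ : ∀ g → A ! g ≡ true → W g ! x ≡ true → Dec (g ≡ f₀) → ⊥₀
    case-f₀ g g∈A _  (yes refl) = true≢false (trans (sym g∈A) f₀∉A)
    case-f₀ g _   Wₓ (no g≢f₀)  = true≢false (trans (sym Wₓ) (S∉W g g≢f₀ x Sₓ))

  Z─W′≡Z─W : ∀ Z → Z ! u ≡ false → ∀ A → Z ─ unionOver W′ A ≡ Z ─ unionOver W A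
  Z─W′≡Z─W Z u∉Z A = p─q≡p─r Z _ _ λ i Zᵢ →
    lookup-unionOver-cong A i λ g → W′≡W g i λ { refl → true≢false (trans (sym Zᵢ) u∉Z) }

  Minimizer∋f₀ : Subset m → Set
  Minimizer∋f₀ Z = ∃ λ A → A ! f₀ ≡ true × term Z A ≡ r Z

  r≤term : ∀ Z A → r Z ≤ term Z A
  r≤term Z = minSub-≤ n (term Z)

  r-mono-∪ : ∀ Z x → r Z ≤ r (Z ∪ ⁅ x ⁆)
  r-mono-∪ Z x = minSub-greatest n _ (r Z) λ B →
    ≤-trans (r≤term Z B) (+-monoʳ-≤ (ρ B) (∣p─q∣≤∣p∪r─q∣ Z (unionOver W B) ⁅ x ⁆))

  term-∪⁅x⁆ : ∀ Z A x → S ! x ≡ true → A ! f₀ ≡ true → term (Z ∪ ⁅ x ⁆) A ≡ term Z A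
  term-∪⁅x⁆ Z A x Sₓ f₀∈A =
    cong (λ T → ρ A + ∣ T ∣) (p∪⁅x⁆─q≡p─q Z (unionOver W A) x (unionOver⁺ W A x f₀ f₀∈A (S⊆Wf₀ x Sₓ)))

  term-∪⁅x⁆′ : ∀ Z A x → S ! x ≡ true → Z ! x ≡ false → A ! f₀ ≡ false → term (Z ∪ ⁅ x ⁆) A ≡ suc (term Z A)
  term-∪⁅x⁆′ Z A x Sₓ x∉Z f₀∉A =
    trans (cong (ρ A +_) (∣p∪⁅x⁆─q∣≡1+∣p─q∣ Z (unionOver W A) x x∉Z (S∩unionOver A x f₀∉A Sₓ))) (+-suc _ _)

  minimizer∋f₀⇒closed : ∀ Z → Minimizer∋f₀ Z → ∀ x → S ! x ≡ true → r (Z ∪ ⁅ x ⁆) ≡ r Z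
  minimizer∋f₀⇒closed Z (A , f₀∈A , tight) x Sₓ = ≤-antisym (begin
    r (Z ∪ ⁅ x ⁆)      ≤⟨ r≤term (Z ∪ ⁅ x ⁆) A ⟩
    term (Z ∪ ⁅ x ⁆) A ≡⟨ term-∪⁅x⁆ Z A x Sₓ f₀∈A ⟩
    term Z A           ≡⟨ tight ⟩
    r Z                ∎) (r-mono-∪ Z x)
    where open ≤-Reasoning

  closed-outside⇒minimizer∋f₀ : ∀ Z x → S ! x ≡ true → Z ! x ≡ false → r (Z ∪ ⁅ x ⁆) ≡ r Z → Minimizer∋f₀ Z
  closed-outside⇒minimizer∋f₀ Z x Sₓ x∉Z closed with minSub-attained n (term (Z ∪ ⁅ x ⁆))
  ... | A , min≡ with A ! f₀ in f₀∈A
  ...   | true  = A , f₀∈A , trans (sym (term-∪⁅x⁆ Z A x Sₓ f₀∈A)) (trans (sym min≡) closed)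
  ...   | false = ⊥-elim (<-irrefl refl (begin-strict
    r Z                ≤⟨ r≤term Z A ⟩
    term Z A           <⟨ n<1+n _ ⟩
    suc (term Z A)     ≡⟨ sym (term-∪⁅x⁆′ Z A x Sₓ x∉Z f₀∈A) ⟩
    term (Z ∪ ⁅ x ⁆) A ≡⟨ sym min≡ ⟩
    r (Z ∪ ⁅ x ⁆)      ≡⟨ closed ⟩
    r Z                ∎))
    where open ≤-Reasoning

  term-∪⁅f₀⁆≤term : ∀ Z A → (∀ x → S ! x ≡ true → Z ! x ≡ true) → A ! f₀ ≡ false
                  → term Z (A ∪ ⁅ f₀ ⁆) ≤ term Z A
  term-∪⁅f₀⁆≤term Z A S⊆Z f₀∉A = begin
    ρ (A ∪ ⁅ f₀ ⁆) + ∣ Z ─ W₊ ∣      ≤⟨ +-monoˡ-≤ _ (ρ-bound A) ⟩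
    ρ A + ∣ S ∣ + ∣ Z ─ W₊ ∣         ≡⟨ +-assoc (ρ A) _ _ ⟩
    ρ A + (∣ S ∣ + ∣ Z ─ W₊ ∣)       ≡⟨ cong (ρ A +_) (+-comm ∣ S ∣ _) ⟩
    ρ A + (∣ Z ─ W₊ ∣ + ∣ S ∣)       ≡⟨ cong (ρ A +_) (sym (∣p∪q∣≡∣p∣+∣q∣ (Z ─ W₊) S disjoint)) ⟩
    ρ A + ∣ (Z ─ W₊) ∪ S ∣           ≤⟨ +-monoʳ-≤ (ρ A) (p⊆q⇒∣p∣≤∣q∣ (lookup-⊆ ((Z ─ W₊) ∪ S) (Z ─ W₀) inside)) ⟩
    ρ A + ∣ Z ─ W₀ ∣                 ∎
    where
    open ≤-Reasoning
    W₀ = unionOver W A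
    W₊ = unionOver W (A ∪ ⁅ f₀ ⁆)
    disjoint : ∀ i → (Z ─ W₊) ! i ≡ true → S ! i ≡ true → ⊥₀
    disjoint i h Sᵢ = true≢false (trans (sym (unionOver⁺ W (A ∪ ⁅ f₀ ⁆) i f₀ (x∈p∪⁅x⁆ A f₀) (S⊆Wf₀ i Sᵢ)))
                                        (proj₂ (x∈p─q⁻ Z W₊ i h)))
    W₀⊆W₊ : ∀ i → W₀ ! i ≡ true → W₊ ! i ≡ true
    W₀⊆W₊ = unionOver-mono W A (A ∪ ⁅ f₀ ⁆) λ g g∈A → trans (lookup-∪ A ⁅ f₀ ⁆ g) (cong (_∨ ⁅ f₀ ⁆ ! g) g∈A)
    inside : ∀ i → ((Z ─ W₊) ∪ S) ! i ≡ true → (Z ─ W₀) ! i ≡ true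
    inside i h with ∨-true⁻ {(Z ─ W₊) ! i} (trans (sym (lookup-∪ (Z ─ W₊) S i)) h)
    ... | inj₁ Z─W₊ᵢ = let Zᵢ , W₊ᵢ = x∈p─q⁻ Z W₊ i Z─W₊ᵢ in
      x∈p─q⁺ Z W₀ i Zᵢ (≢true⇒≡false λ Wᵢ → true≢false (trans (sym (W₀⊆W₊ i Wᵢ)) W₊ᵢ))
    ... | inj₂ Sᵢ = x∈p─q⁺ Z W₀ i (S⊆Z i Sᵢ) (S∩unionOver A i f₀∉A Sᵢ)

  S⊆Z⇒minimizer∋f₀ : ∀ Z → (∀ x → S ! x ≡ true → Z ! x ≡ true) → Minimizer∋f₀ Z
  S⊆Z⇒minimizer∋f₀ Z S⊆Z with minSub-attained n (term Z)
  ... | A , min≡ with A ! f₀ in f₀∈A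
  ...   | true  = A , f₀∈A , sym min≡
  ...   | false = A ∪ ⁅ f₀ ⁆ , x∈p∪⁅x⁆ A f₀ ,
    ≤-antisym (≤-trans (term-∪⁅f₀⁆≤term Z A S⊆Z f₀∈A) (≤-reflexive (sym min≡))) (r≤term Z _)

  closed⇒minimizer∋f₀ : ∀ Z → (∀ x → S ! x ≡ true → r (Z ∪ ⁅ x ⁆) ≡ r Z) → Minimizer∋f₀ Z
  closed⇒minimizer∋f₀ Z closed with Fin.any? (λ x → S ! x ∧ not (Z ! x) Bool.≟ true)
  ... | yes (x , S∖Zₓ) = let Sₓ , x∉Z = ∧-true⁻ {S ! x} S∖Zₓ in
    closed-outside⇒minimizer∋f₀ Z x Sₓ (trans (sym (not-involutive (Z ! x))) (cong not x∉Z)) (closed x Sₓ)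
  ... | no  S⊆Z = S⊆Z⇒minimizer∋f₀ Z λ x Sₓ → ¬-not λ x∉Z → S⊆Z (x , cong₂ (λ a b → a ∧ not b) Sₓ x∉Z)

  module _ (Z : Subset m) (u∈Z : Z ! u ≡ true) where

    Z₀ : Subset m
    Z₀ = Z ─ ⁅ u ⁆

    u∉Z₀ : Z₀ ! u ≡ false
    u∉Z₀ = trans (lookup-─ Z ⁅ u ⁆ u) (trans (cong (λ b → Z ! u ∧ not b) (lookup-⁅x⁆ u)) (∧-zeroʳ _))

    term′≡term : ∀ A → A ! f₀ ≡ true → term′ Z A ≡ term Z₀ A
    term′≡term A f₀∈A = cong (λ T → ρ A + ∣ T ∣) (begin
      Z ─ unionOver W′ A            ≡⟨ cong (_─ unionOver W′ A) (sym (p─⁅x⁆∪⁅x⁆≡p Z u u∈Z)) ⟩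
      (Z₀ ∪ ⁅ u ⁆) ─ unionOver W′ A ≡⟨ p∪⁅x⁆─q≡p─q Z₀ (unionOver W′ A) u u∈W′A ⟩
      Z₀ ─ unionOver W′ A           ≡⟨ Z─W′≡Z─W Z₀ u∉Z₀ A ⟩
      Z₀ ─ unionOver W A            ∎)
      where
      open ≡-Reasoning
      u∈W′A = trans (lookup-unionOver-W′-u A) f₀∈A

    term′≡1+term : ∀ A → A ! f₀ ≡ false → term′ Z A ≡ suc (term Z₀ A)
    term′≡1+term A f₀∉A = trans (cong (ρ A +_) (begin
      ∣ Z ─ unionOver W′ A ∣            ≡⟨ cong (λ T → ∣ T ─ unionOver W′ A ∣) (sym (p─⁅x⁆∪⁅x⁆≡p Z u u∈Z)) ⟩
      ∣ (Z₀ ∪ ⁅ u ⁆) ─ unionOver W′ A ∣ ≡⟨ ∣p∪⁅x⁆─q∣≡1+∣p─q∣ Z₀ (unionOver W′ A) u u∉Z₀ u∉W′A ⟩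
      suc ∣ Z₀ ─ unionOver W′ A ∣       ≡⟨ cong (suc ∘ ∣_∣) (Z─W′≡Z─W Z₀ u∉Z₀ A) ⟩
      suc ∣ Z₀ ─ unionOver W A ∣        ∎)) (+-suc _ _)
      where
      open ≡-Reasoning
      u∉W′A = trans (lookup-unionOver-W′-u A) f₀∉A

    term≤term′ : ∀ A → term Z₀ A ≤ term′ Z A
    term≤term′ A with A ! f₀ in f₀∈A
    ... | true  = ≤-reflexive (sym (term′≡term A f₀∈A))
    ... | false = ≤-trans (n≤1+n _) (≤-reflexive (sym (term′≡1+term A f₀∈A)))

    natRank-W′-minimizer∋f₀ : Minimizer∋f₀ Z₀ → natRank ρ W′ Z ≡ r Z₀
    natRank-W′-minimizer∋f₀ (A , f₀∈A , tight) =
      minSub-≡ n (term′ Z) (r Z₀) A (≤-reflexive (trans (term′≡term A f₀∈A) tight))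
               (λ B → ≤-trans (r≤term Z₀ B) (term≤term′ B))

    natRank-W′-no-minimizer∋f₀ : ¬ Minimizer∋f₀ Z₀ → natRank ρ W′ Z ≡ suc (r Z₀)
    natRank-W′-no-minimizer∋f₀ none with minSub-attained n (term Z₀)
    ... | A₀ , min≡ = minSub-≡ n (term′ Z) (suc (r Z₀)) A₀ (≤-reflexive attained) bounded
      where
      attained : term′ Z A₀ ≡ suc (r Z₀)
      attained with A₀ ! f₀ in f₀∈A₀
      ... | true  = ⊥-elim (none (A₀ , f₀∈A₀ , sym min≡))
      ... | false = trans (term′≡1+term A₀ f₀∈A₀) (cong suc (sym min≡))
      bounded : ∀ B → suc (r Z₀) ≤ term′ Z B
      bounded B with B ! f₀ in f₀∈B
      ... | true  = ≤-trans (≤∧≢⇒< (r≤term Z₀ B) (λ tight → none (B , f₀∈B , sym tight)))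
                            (≤-reflexive (sym (term′≡term B f₀∈B)))
      ... | false = ≤-trans (s≤s (r≤term Z₀ B)) (≤-reflexive (sym (term′≡1+term B f₀∈B)))

  principalExt≗natRank : principalExt r u S ≗ natRank ρ W′
  principalExt≗natRank Z with Z ! u in u∈Z
  ... | false = minSub-cong n λ A → cong (λ T → ρ A + ∣ T ∣) (sym (Z─W′≡Z─W Z u∈Z A))
  ... | true with subsetClosure r (Z ─ ⁅ u ⁆) S in closed
  ...   | true  = trans (+-identityʳ _) (sym (natRank-W′-minimizer∋f₀ Z u∈Z
                    (closed⇒minimizer∋f₀ (Z ─ ⁅ u ⁆) (subsetClosure⁻ r (Z ─ ⁅ u ⁆) S closed))))
  ...   | false = trans (+-comm _ 1) (sym (natRank-W′-no-minimizer∋f₀ Z u∈Z λ minimizer →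
                    true≢false (trans (sym (subsetClosure⁺ r (Z ─ ⁅ u ⁆) S
                                             (minimizer∋f₀⇒closed (Z ─ ⁅ u ⁆) minimizer))) closed)))

-- k-natural matroids

listSet : ∀ {m} → List (Fin m) → Subset m
listSet R = ⋃ (List.map ⁅_⁆ R)

listSet-∈ : ∀ {m} {R : List (Fin m)} {i} → i ∈ₗ R → listSet R ! i ≡ true
listSet-∈ {R = u ∷ R} (here refl) =
  trans (lookup-∪ ⁅ u ⁆ (listSet R) u) (cong (_∨ listSet R ! u) (lookup-⁅x⁆ u))
listSet-∈ {R = u ∷ R} {i} (there i∈R) =
  trans (lookup-∪ ⁅ u ⁆ (listSet R) i) (trans (cong (⁅ u ⁆ ! i ∨_) (listSet-∈ i∈R)) (∨-zeroʳ _))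

listSet-∉ : ∀ {m} {R : List (Fin m)} {i} → All (i ≢_) R → listSet R ! i ≡ false
listSet-∉ {i = i} [] = lookup-⊥ i
listSet-∉ {R = v ∷ R} {i} (i≢v ∷ i∉R) =
  trans (lookup-∪ ⁅ v ⁆ (listSet R) i) (cong₂ _∨_ (lookup-⁅y⁆ v i≢v) (listSet-∉ i∉R))

listSet-∷-≢ : ∀ {m} u (R : List (Fin m)) {i} → i ≢ u → listSet (u ∷ R) ! i ≡ listSet R ! i
listSet-∷-≢ u R {i} i≢u = trans (lookup-∪ ⁅ u ⁆ (listSet R) i) (cong (_∨ listSet R ! i) (lookup-⁅y⁆ u i≢u))

module KNatural {n m : ℕ} (ρ : Subset n → ℕ) (X U : Fin n → Subset m)
                (X-disjoint : PairwiseDisjoint X) (U-disjoint : PairwiseDisjoint U)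
                (U∩X : ∀ f g → Empty (U f ∩ X g))
                (ρ-bound : ∀ f A → ρ (A ∪ ⁅ f ⁆) ≤ ρ A + ∣ X f ∣) where

  -- the family once every element except those of R has been added freely
  family : List (Fin m) → Fin n → Subset m
  family R f = X f ∪ (U f ─ listSet R)

  lookup-family : ∀ R f i → family R f ! i ≡ X f ! i ∨ (U f ! i ∧ not (listSet R ! i))
  lookup-family R f i = trans (lookup-∪ (X f) _ i) (cong (X f ! i ∨_) (lookup-─ (U f) (listSet R) i))

  family-∷-≢ : ∀ {u} R f i → i ≢ u → family (u ∷ R) f ! i ≡ family R f ! i
  family-∷-≢ {u} R f i i≢u =
    trans (lookup-family (u ∷ R) f i) (trans (cong (λ b → X f ! i ∨ (U f ! i ∧ not b)) (listSet-∷-≢ u R i≢u))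
                                              (sym (lookup-family R f i)))

  -- kNatRank ρ X U unfolds to List.foldl step (natRank ρ X) (allFin m)
  extend : Fin m → (Subset m → ℕ) → Fin n → Subset m → ℕ
  extend u r f = if U f ! u then principalExt r u (X f) else r

  step : (Subset m → ℕ) → Fin m → Subset m → ℕ
  step r u = List.foldl (extend u) r (allFin n)

  foldl-extend-skip : ∀ {u} L r → All (λ f → U f ! u ≡ false) L → List.foldl (extend u) r L ≡ r
  foldl-extend-skip []      r []          = refl
  foldl-extend-skip (f ∷ L) r (u∉Uf ∷ rest) rewrite u∉Uf = foldl-extend-skip L r rest

  module _ {u : Fin m} {f₀ : Fin n} (u∈Uf₀ : U f₀ ! u ≡ true) where

    u∉U : ∀ f → f ≢ f₀ → U f ! u ≡ false
    u∉U f f≢f₀ = Empty-∩⁻ (U f₀) (U f) (U-disjoint f₀ f (f≢f₀ ∘ sym)) u u∈Uf₀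

    foldl-extend-only : ∀ L r → Unique L → f₀ ∈ₗ L → List.foldl (extend u) r L ≡ principalExt r u (X f₀)
    foldl-extend-only (f ∷ L) r (f≢L ∷ _) (here refl) rewrite u∈Uf₀ =
      foldl-extend-skip L _ (All.map (λ {g} f₀≢g → u∉U g (f₀≢g ∘ sym)) f≢L)
    foldl-extend-only (f ∷ L) r (f≢L ∷ unique) (there f₀∈L) rewrite u∉U f (All.lookup f≢L f₀∈L) =
      foldl-extend-only L r unique f₀∈L

    u∉X : ∀ g → X g ! u ≡ false
    u∉X g = Empty-∩⁻ (U f₀) (X g) (U∩X f₀ g) u u∈Uf₀

    adding-u-to-Xf₀ : ∀ R → All (u ≢_) R
                    → principalExt (natRank ρ (family (u ∷ R))) u (X f₀) ≗ natRank ρ (family R)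
    adding-u-to-Xf₀ R u∉R = PrincipalExtension.principalExt≗natRank ρ (family (u ∷ R)) (family R) u f₀ (X f₀)
      (λ g i i≢u → sym (family-∷-≢ R g i i≢u)) u∈family-f₀ u∉family
      (λ i Xᵢ → trans (lookup-family (u ∷ R) f₀ i) (cong (_∨ _) Xᵢ)) Xf₀∉family (ρ-bound f₀)
      where
      u∈family-f₀ : family R f₀ ! u ≡ true
      u∈family-f₀ rewrite lookup-family R f₀ u | u∈Uf₀ | listSet-∉ u∉R = ∨-zeroʳ _
      u∉family : ∀ g → g ≢ f₀ → family R g ! u ≡ false
      u∉family g g≢f₀ rewrite lookup-family R g u | u∉X g | u∉U g g≢f₀ = refl
      Xf₀∉family : ∀ g → g ≢ f₀ → ∀ i → X f₀ ! i ≡ true → family (u ∷ R) g ! i ≡ false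
      Xf₀∉family g g≢f₀ i Xᵢ
        rewrite lookup-family (u ∷ R) g i
              | Empty-∩⁻ (X f₀) (X g) (X-disjoint f₀ g (g≢f₀ ∘ sym)) i Xᵢ
              | Empty-∩⁻ʳ (U g) (X f₀) (U∩X g f₀) i Xᵢ = refl

  step-invariant : ∀ u R r → All (u ≢_) R → r ≗ natRank ρ (family (u ∷ R)) → step r u ≗ natRank ρ (family R)
  step-invariant u R r u∉R r≗ Z with Fin.any? (λ f → U f ! u Bool.≟ true)
  ... | yes (f₀ , u∈Uf₀) = begin
    step r u Z                                           ≡⟨ cong (λ q → q Z) extend-once ⟩
    principalExt r u (X f₀) Z                            ≡⟨ principalExt-cong r≗ u (X f₀) Z ⟩
    principalExt (natRank ρ (family (u ∷ R))) u (X f₀) Z ≡⟨ adding-u-to-Xf₀ u∈Uf₀ R u∉R Z ⟩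
    natRank ρ (family R) Z                               ∎
    where
    open ≡-Reasoning
    extend-once = foldl-extend-only u∈Uf₀ (allFin n) r (allFin⁺ n) (∈-allFin f₀)
  ... | no  u∉U = begin
    step r u Z                   ≡⟨ cong (λ q → q Z) extend-never ⟩
    r Z                          ≡⟨ r≗ Z ⟩
    natRank ρ (family (u ∷ R)) Z ≡⟨ natRank-cong ρ same Z ⟩
    natRank ρ (family R) Z       ∎
    where
    open ≡-Reasoning
    u∉Uf : ∀ f → U f ! u ≡ false
    u∉Uf f = ≢true⇒≡false λ h → u∉U (f , h)
    extend-never = foldl-extend-skip (allFin n) r (All.tabulate λ {f} _ → u∉Uf f)
    same : ∀ f i → family (u ∷ R) f ! i ≡ family R f ! i
    same f i with i Fin.≟ u
    ... | yes refl rewrite lookup-family (u ∷ R) f i | lookup-family R f i | u∉Uf f = refl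
    ... | no  i≢u  = family-∷-≢ R f i i≢u

  foldl-step : ∀ R r → Unique R → r ≗ natRank ρ (family R) → List.foldl step r R ≗ natRank ρ (family [])
  foldl-step []      r []             r≗ = r≗
  foldl-step (u ∷ R) r (u∉R ∷ unique) r≗ = foldl-step R (step r u) unique (step-invariant u R r u∉R r≗)

  kNatRank≗natRank : kNatRank ρ X U ≗ natRank ρ (λ f → X f ∪ U f)
  kNatRank≗natRank Z = trans (foldl-step (allFin m) (natRank ρ X) (allFin⁺ m) (natRank-cong ρ initial) Z)
                             (natRank-cong ρ final Z)
    where
    initial : ∀ f i → X f ! i ≡ family (allFin m) f ! i
    initial f i rewrite lookup-family (allFin m) f i | listSet-∈ (∈-allFin i) | ∧-zeroʳ (U f ! i) =
      sym (∨-identityʳ _)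
    final : ∀ f i → family [] f ! i ≡ (X f ∪ U f) ! i
    final f i = cong (λ T → (X f ∪ T) ! i) (p─⊥≡p (U f))

-- The compressed polymatroid as a minor

module CompressionMinor {n m : ℕ} (ρ : Subset (suc n) → ℕ) (e : Fin (suc n))
         (X : Fin (suc n) → Subset m) (e₁ : Fin m) (Y : Subset m)
         (poly : IsPolymatroid ρ) (ρe>0 : 0 < ρ ⁅ e ⁆)
         (X-disjoint : PairwiseDisjoint X) (∣X∣≡ρ : ∀ f → ∣ X f ∣ ≡ ρ ⁅ f ⁆) (e₁∈Xₑ : e₁ ∈ X e)
         (Y⊆parallel : ∀ y → y ∈ Y
                     → ∃ λ g → ρ (⁅ e ⁆ ∪ ⁅ punchIn e g ⁆) ≡ ρ ⁅ punchIn e g ⁆ × y ∈ X (punchIn e g))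
         (∣Y∩X∣≡1 : ∀ g → ρ (⁅ e ⁆ ∪ ⁅ punchIn e g ⁆) ≡ ρ ⁅ punchIn e g ⁆ → ∣ Y ∩ X (punchIn e g) ∣ ≡ 1) where

  open Compression ρ e poly ρe>0 using (compress-subadditive)

  X₋ : Fin n → Subset m
  X₋ g = X (punchIn e g)

  X′ : Fin n → Subset m
  X′ g = X₋ g ─ Y

  punchIn-≢ : ∀ {g h} → g ≢ h → punchIn e g ≢ punchIn e h
  punchIn-≢ {g} {h} g≢h = g≢h ∘ Fin.punchIn-injective e g h

  X-apart : ∀ {f g} → f ≢ g → ∀ i → X f ! i ≡ true → X g ! i ≡ false
  X-apart {f} {g} f≢g = Empty-∩⁻ (X f) (X g) (X-disjoint f g f≢g)

  e₁∈Xₑ! : X e ! e₁ ≡ true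
  e₁∈Xₑ! = []=⇒lookup e₁∈Xₑ

  e₁∉X₋ : ∀ g → X₋ g ! e₁ ≡ false
  e₁∉X₋ g = X-apart (Fin.punchInᵢ≢i e g ∘ sym) e₁ e₁∈Xₑ!

  lookup-X′ : ∀ g i → X′ g ! i ≡ X₋ g ! i ∧ not (Y ! i)
  lookup-X′ g = lookup-─ (X₋ g) Y

  Parallel : Fin n → Set
  Parallel g = ρ (⁅ e ⁆ ∪ ⁅ punchIn e g ⁆) ≡ ρ ⁅ punchIn e g ⁆

  compress-⁅g⁆ : ∀ g → compress ρ e ⁅ g ⁆
               ≡ decrementIf (does (ρ (⁅ e ⁆ ∪ ⁅ punchIn e g ⁆) ≟ ρ ⁅ punchIn e g ⁆)) (ρ ⁅ punchIn e g ⁆)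
  compress-⁅g⁆ g = cong₂ (λ S T → decrementIf (does (ρ S ≟ ρ T)) (ρ T))
                         (trans (cong (_∪ ⁅ e ⁆) (liftSub⁅g⁆ e g)) (∪-comm _ ⁅ e ⁆)) (liftSub⁅g⁆ e g)

  compress-parallel : ∀ g → Parallel g → compress ρ e ⁅ g ⁆ ≡ ρ ⁅ punchIn e g ⁆ ∸ 1
  compress-parallel g parallel =
    trans (compress-⁅g⁆ g) (cong (flip decrementIf (ρ ⁅ punchIn e g ⁆)) (dec-true (_ ≟ _) parallel))

  compress-not-parallel : ∀ g → ¬ Parallel g → compress ρ e ⁅ g ⁆ ≡ ρ ⁅ punchIn e g ⁆
  compress-not-parallel g not-parallel =
    trans (compress-⁅g⁆ g) (cong (flip decrementIf (ρ ⁅ punchIn e g ⁆)) (dec-false (_ ≟ _) not-parallel))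

  ρ⁅f⁆≡∣Y∩X∣+∣X′∣ : ∀ g → ρ ⁅ punchIn e g ⁆ ≡ ∣ Y ∩ X₋ g ∣ + ∣ X′ g ∣
  ρ⁅f⁆≡∣Y∩X∣+∣X′∣ g = begin
    ρ ⁅ punchIn e g ⁆          ≡⟨ sym (∣X∣≡ρ (punchIn e g)) ⟩
    ∣ X₋ g ∣                   ≡⟨ ∣p∣≡∣p∩q∣+∣p─q∣ (X₋ g) Y ⟩
    ∣ X₋ g ∩ Y ∣ + ∣ X′ g ∣    ≡⟨ cong (λ T → ∣ T ∣ + ∣ X′ g ∣) (∩-comm (X₋ g) Y) ⟩
    ∣ Y ∩ X₋ g ∣ + ∣ X′ g ∣    ∎
    where open ≡-Reasoning

  Y∩X≡⊥ : ∀ g → ¬ Parallel g → Y ∩ X₋ g ≡ ⊥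
  Y∩X≡⊥ g not-parallel = ≗⇒≡ λ i → trans (≢true⇒≡false (nothing-in i)) (sym (lookup-⊥ i))
    where
    nothing-in : ∀ i → ¬ (Y ∩ X₋ g) ! i ≡ true
    nothing-in i h with ∧-true⁻ {Y ! i} (trans (sym (lookup-∩ Y (X₋ g) i)) h)
    ... | Yᵢ , Xᵢ with Y⊆parallel i (lookup⇒[]= i Y Yᵢ)
    ... | g′ , parallel , i∈X with g′ Fin.≟ g
    ...   | yes refl = not-parallel parallel
    ...   | no  g′≢g = true≢false (trans (sym Xᵢ) (X-apart (punchIn-≢ g′≢g) i ([]=⇒lookup i∈X)))

  ∣X′∣≡compress : ∀ g → ∣ X′ g ∣ ≡ compress ρ e ⁅ g ⁆
  ∣X′∣≡compress g with ρ (⁅ e ⁆ ∪ ⁅ punchIn e g ⁆) ≟ ρ ⁅ punchIn e g ⁆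
  ... | yes parallel = begin
    ∣ X′ g ∣                  ≡⟨⟩
    suc ∣ X′ g ∣ ∸ 1          ≡⟨ cong (_∸ 1) (cong (_+ ∣ X′ g ∣) (sym (∣Y∩X∣≡1 g parallel))) ⟩
    ∣ Y ∩ X₋ g ∣ + ∣ X′ g ∣ ∸ 1 ≡⟨ cong (_∸ 1) (sym (ρ⁅f⁆≡∣Y∩X∣+∣X′∣ g)) ⟩
    ρ ⁅ punchIn e g ⁆ ∸ 1     ≡⟨ sym (compress-parallel g parallel) ⟩
    compress ρ e ⁅ g ⁆        ∎
    where open ≡-Reasoning
  ... | no  not-parallel = begin
    ∣ X′ g ∣                  ≡⟨ cong (_+ ∣ X′ g ∣) (sym (∣⊥∣≡0 m)) ⟩
    ∣ ⊥ {m} ∣ + ∣ X′ g ∣      ≡⟨ cong (λ T → ∣ T ∣ + ∣ X′ g ∣) (sym (Y∩X≡⊥ g not-parallel)) ⟩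
    ∣ Y ∩ X₋ g ∣ + ∣ X′ g ∣   ≡⟨ sym (ρ⁅f⁆≡∣Y∩X∣+∣X′∣ g) ⟩
    ρ ⁅ punchIn e g ⁆         ≡⟨ sym (compress-not-parallel g not-parallel) ⟩
    compress ρ e ⁅ g ⁆        ∎
    where open ≡-Reasoning

  natRank-compress : ∀ Z → Z ⊆ unionOver X′ ⊤
                   → natRank (compress ρ e) X′ Z ≡ contractRank (natRank ρ X) ⁅ e₁ ⁆ Z
  natRank-compress Z Z⊆X′ = Contraction.contraction ρ e poly ρe>0 X X′ e₁ e₁∈Xₑ! e₁∉X₋ Z compatible
    where
    compatible : ∀ i → Z ! i ≡ true → X e ! i ≡ false × (∀ g → X′ g ! i ≡ X₋ g ! i)
    compatible i Zᵢ with unionOver⁻ X′ ⊤ i ([]=⇒lookup (Z⊆X′ (lookup⇒[]= i Z Zᵢ)))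
    ... | g₀ , _ , X′ᵢ with x∈p─q⁻ (X₋ g₀) Y i X′ᵢ
    ... | Xᵢ , i∉Y = X-apart (Fin.punchInᵢ≢i e g₀) i Xᵢ ,
                     λ g → trans (lookup-X′ g i) (trans (cong (λ b → X₋ g ! i ∧ not b) i∉Y) (∧-identityʳ _))

  module _ (U : Fin (suc n) → Subset m) (U-disjoint : PairwiseDisjoint U)
           (U∩X : ∀ f g → Empty (U f ∩ X g)) where

    U₋ U′ : Fin n → Subset m
    U₋ g = U (punchIn e g)
    U′ g = U₋ g ∪ (X₋ g ∩ Y)

    U-apart : ∀ {f g} → f ≢ g → ∀ i → U f ! i ≡ true → U g ! i ≡ false
    U-apart {f} {g} f≢g = Empty-∩⁻ (U f) (U g) (U-disjoint f g f≢g)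

    U∌X : ∀ f g i → X g ! i ≡ true → U f ! i ≡ false
    U∌X f g = Empty-∩⁻ʳ (U f) (X g) (U∩X f g)

    X∌U : ∀ f g i → U f ! i ≡ true → X g ! i ≡ false
    X∌U f g = Empty-∩⁻ (U f) (X g) (U∩X f g)

    V : Fin (suc n) → Subset m
    V f = X f ∪ U f

    V-apart : ∀ {f g} → f ≢ g → ∀ i → V f ! i ≡ true → V g ! i ≡ false
    V-apart {f} {g} f≢g i Vᵢ with ∨-true⁻ {X f ! i} (trans (sym (lookup-∪ (X f) (U f) i)) Vᵢ)
    ... | inj₁ Xᵢ = trans (lookup-∪ (X g) (U g) i) (cong₂ _∨_ (X-apart f≢g i Xᵢ) (U∌X g f i Xᵢ))
    ... | inj₂ Uᵢ = trans (lookup-∪ (X g) (U g) i) (cong₂ _∨_ (X∌U f g i Uᵢ) (U-apart f≢g i Uᵢ))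

    X′∪U′ : ∀ g i → (X′ g ∪ U′ g) ! i ≡ (X₋ g ∪ U₋ g) ! i
    X′∪U′ g i
      rewrite lookup-∪ (X′ g) (U′ g) i | lookup-X′ g i | lookup-∪ (U₋ g) (X₋ g ∩ Y) i
            | lookup-∩ (X₋ g) Y i | lookup-∪ (X₋ g) (U₋ g) i
      = boolean (X₋ g ! i) (Y ! i) (U₋ g ! i)
      where
      boolean : ∀ x y u → (x ∧ not y) ∨ (u ∨ (x ∧ y)) ≡ x ∨ u
      boolean false _     u     = ∨-identityʳ u
      boolean true  false _     = refl
      boolean true  true  false = refl
      boolean true  true  true  = refl

    U′⁻ : ∀ g i → U′ g ! i ≡ true → U₋ g ! i ≡ true ⊎ X₋ g ! i ≡ true × Y ! i ≡ true
    U′⁻ g i h with ∨-true⁻ {U₋ g ! i} (trans (sym (lookup-∪ (U₋ g) (X₋ g ∩ Y) i)) h)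
    ... | inj₁ Uᵢ  = inj₁ Uᵢ
    ... | inj₂ XYᵢ = inj₂ (∧-true⁻ (trans (sym (lookup-∩ (X₋ g) Y i)) XYᵢ))

    U′-∌ : ∀ h i → U₋ h ! i ≡ false → X₋ h ! i ≡ false → U′ h ! i ≡ false
    U′-∌ h i Uᵢ Xᵢ =
      trans (lookup-∪ (U₋ h) (X₋ h ∩ Y) i) (cong₂ _∨_ Uᵢ (trans (lookup-∩ (X₋ h) Y i) (cong (_∧ Y ! i) Xᵢ)))

    X′-disjoint : PairwiseDisjoint X′
    X′-disjoint g h g≢h = Empty-∩⁺ (X′ g) (X′ h) λ i X′ᵢ →
      trans (lookup-X′ h i)
            (cong (_∧ not (Y ! i)) (X-apart (punchIn-≢ g≢h) i (proj₁ (x∈p─q⁻ (X₋ g) Y i X′ᵢ))))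

    U′-disjoint : PairwiseDisjoint U′
    U′-disjoint g h g≢h = Empty-∩⁺ (U′ g) (U′ h) λ i U′ᵢ → apart i (U′⁻ g i U′ᵢ)
      where
      apart : ∀ i → U₋ g ! i ≡ true ⊎ X₋ g ! i ≡ true × Y ! i ≡ true → U′ h ! i ≡ false
      apart i (inj₁ Uᵢ)       = U′-∌ h i (U-apart (punchIn-≢ g≢h) i Uᵢ) (X∌U _ _ i Uᵢ)
      apart i (inj₂ (Xᵢ , _)) = U′-∌ h i (U∌X _ _ i Xᵢ) (X-apart (punchIn-≢ g≢h) i Xᵢ)

    U′∩X′ : ∀ g h → Empty (U′ g ∩ X′ h)
    U′∩X′ g h = Empty-∩⁺ (U′ g) (X′ h) λ i U′ᵢ → apart i (U′⁻ g i U′ᵢ)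
      where
      apart : ∀ i → U₋ g ! i ≡ true ⊎ X₋ g ! i ≡ true × Y ! i ≡ true → X′ h ! i ≡ false
      apart i (inj₁ Uᵢ)       = trans (lookup-X′ h i) (cong (_∧ not (Y ! i)) (X∌U _ _ i Uᵢ))
      apart i (inj₂ (_ , Yᵢ)) = trans (lookup-X′ h i) (trans (cong (λ b → X₋ h ! i ∧ not b) Yᵢ) (∧-zeroʳ _))

    kNatRank-compress : ∀ Z → Z ⊆ unionOver (λ g → X₋ g ∪ U₋ g) ⊤
                      → kNatRank (compress ρ e) X′ U′ Z ≡ contractRank (kNatRank ρ X U) ⁅ e₁ ⁆ Z
    kNatRank-compress Z Z⊆ = begin
      kNatRank (compress ρ e) X′ U′ Z              ≡⟨ compressed-kNatural Z ⟩
      natRank (compress ρ e) (λ g → X′ g ∪ U′ g) Z ≡⟨ contraction Z compatible ⟩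
      contractRank (natRank ρ V) ⁅ e₁ ⁆ Z          ≡⟨ cong₂ _∸_ (sym (kNatural _)) (sym (kNatural _)) ⟩
      contractRank (kNatRank ρ X U) ⁅ e₁ ⁆ Z       ∎
      where
      open ≡-Reasoning
      ρ-bound : ∀ f A → ρ (A ∪ ⁅ f ⁆) ≤ ρ A + ∣ X f ∣
      ρ-bound f A = subst (λ k → ρ (A ∪ ⁅ f ⁆) ≤ ρ A + k) (sym (∣X∣≡ρ f)) (subadditive poly A ⁅ f ⁆)
      compress-bound : ∀ g A → compress ρ e (A ∪ ⁅ g ⁆) ≤ compress ρ e A + ∣ X′ g ∣
      compress-bound g A = subst (λ k → compress ρ e (A ∪ ⁅ g ⁆) ≤ compress ρ e A + k) (sym (∣X′∣≡compress g))
                                 (compress-subadditive A ⁅ g ⁆)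

      kNatural : kNatRank ρ X U ≗ natRank ρ V
      kNatural = KNatural.kNatRank≗natRank ρ X U X-disjoint U-disjoint U∩X ρ-bound
      compressed-kNatural : kNatRank (compress ρ e) X′ U′ ≗ natRank (compress ρ e) (λ g → X′ g ∪ U′ g)
      compressed-kNatural =
        KNatural.kNatRank≗natRank (compress ρ e) X′ U′ X′-disjoint U′-disjoint U′∩X′ compress-bound

      e₁∈V : V e ! e₁ ≡ true
      e₁∈V = trans (lookup-∪ (X e) (U e) e₁) (cong (_∨ U e ! e₁) e₁∈Xₑ!)
      e₁∉V : ∀ g → V (punchIn e g) ! e₁ ≡ false
      e₁∉V g = V-apart (Fin.punchInᵢ≢i e g ∘ sym) e₁ e₁∈V
      open Contraction ρ e poly ρe>0 V (λ g → X′ g ∪ U′ g) e₁ e₁∈V e₁∉V using (contraction)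

      compatible : ∀ i → Z ! i ≡ true → V e ! i ≡ false × (∀ g → (X′ g ∪ U′ g) ! i ≡ V (punchIn e g) ! i)
      compatible i Zᵢ with unionOver⁻ (λ g → X₋ g ∪ U₋ g) ⊤ i ([]=⇒lookup (Z⊆ (lookup⇒[]= i Z Zᵢ)))
      ... | g₀ , _ , Vᵢ = V-apart (Fin.punchInᵢ≢i e g₀) i Vᵢ , λ g → X′∪U′ g i

lemma5p1 : ∀ {n m : ℕ} (ρ : Subset (suc n) → ℕ) (e : Fin (suc n))
    (X : Fin (suc n) → Subset m) (e₁ : Fin m) (Y : Subset m)
    → IsPolymatroid ρ
    → 0 < ρ ⁅ e ⁆
    → PairwiseDisjoint X
    → (∀ f → ∣ X f ∣ ≡ ρ ⁅ f ⁆)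
    → e₁ ∈ X e
    → (∀ y → y ∈ Y → ∃ λ g → ρ (⁅ e ⁆ ∪ ⁅ punchIn e g ⁆) ≡ ρ ⁅ punchIn e g ⁆ × y ∈ X (punchIn e g))
    → (∀ g → ρ (⁅ e ⁆ ∪ ⁅ punchIn e g ⁆) ≡ ρ ⁅ punchIn e g ⁆ → ∣ Y ∩ X (punchIn e g) ∣ ≡ 1)
    → let X′ : Fin n → Subset m
          X′ g = X (punchIn e g) ─ Y
      in (∀ g → ∣ X′ g ∣ ≡ compress ρ e ⁅ g ⁆)
         × (∀ Z → Z ⊆ unionOver X′ ⊤
              → natRank (compress ρ e) X′ Z ≡ contractRank (natRank ρ X) ⁅ e₁ ⁆ Z)
         × (∀ (k : ℕ) (U : Fin (suc n) → Subset m)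
              → IsKPolymatroid k ρ
              → PairwiseDisjoint U
              → (∀ f g → Empty (U f ∩ X g))
              → (∀ f → ∣ U f ∣ ≡ k ∸ ρ ⁅ f ⁆)
              → ∀ Z → Z ⊆ unionOver (λ g → X (punchIn e g) ∪ U (punchIn e g)) ⊤
              → kNatRank (compress ρ e) X′ (λ g → U (punchIn e g) ∪ (X (punchIn e g) ∩ Y)) Z
                ≡ contractRank (kNatRank ρ X U) ⁅ e₁ ⁆ Z)
lemma5p1 ρ e X e₁ Y poly ρe>0 X-disjoint ∣X∣≡ρ e₁∈Xₑ Y⊆parallel ∣Y∩X∣≡1 =
  ∣X′∣≡compress , natRank-compress , λ k U _ U-disjoint U∩X _ → kNatRank-compress U U-disjoint U∩X
  where open CompressionMinor ρ e X e₁ Y poly ρe>0 X-disjoint ∣X∣≡ρ e₁∈Xₑ Y⊆parallel ∣Y∩X∣≡1
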